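{- Let $1\le i\le n-1$, let $f_1,g_1$ be Laurent polynomials in $x_1,\dots,x_n$, $f_2=f_1\pi_{n-i}$, $g_2=g_1\widehat\pi_i$. If $(f_1,g_1)^A=0$ and $(f_2,g_1)^A=1$, then $(f_1,g_2)^A=1$ and $(f_2,g_2)^A=0$. Moreover, any linear space $V$ of Laurent polynomials stable under $\pi_{n-i}$ and orthogonal to $g_1$ is orthogonal to $g_2$.
   Context: Operators written on the right. $f\pi_j=\frac{x_jf-x_{j+1}f^{s_j}}{x_j-x_{j+1}}$ with $s_j$ exchanging $x_j,x_{j+1}$, and $\widehat\pi_j=\pi_j-1$. $(f,g)^A=\mathrm{CT}\big(f(x_1,\dots,x_n)g(x_n^{ -1},\dots,x_1^{ -1})\prod_{1\le j<k\le n}(1-x_jx_k^{ -1})\big)$, CT the constant term in $x_1,\dots,x_n$. -}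

module Defs where

open import Level using (Level; _⊔_)
open import Algebra.Bundles using (CommutativeRing)
open import Data.Nat as ℕ using (ℕ; zero; suc; _<ᵇ_; _≡ᵇ_)
open import Data.Integer as ℤ using (ℤ; +_)
open import Data.Fin as Fin using (Fin; toℕ)
open import Data.Vec as Vec using (Vec; []; _∷_)
open import Data.Vec.Properties using (≡-dec)
open import Data.List as List using (List; []; _∷_; _++_)
open import Data.Bool using (if_then_else_)
open import Data.Product using (_×_; _,_; Σ)
open import Relation.Nullary using (yes; no)

-- Exponent vectors of Laurent monomials in x_1,…,x_n (entry k-1 = exponent of x_k).
Exp : ℕ → Set
Exp n = Vec ℤ n

-- unit exponent vector of x_j, j given 1-based (x_j with j∉[1,n] gives the zero vector,
-- never used in that way)
unitExp : (n j : ℕ) → Exp n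
unitExp n j = Vec.tabulate (λ (k : Fin n) → if ℕ.suc (toℕ k) ≡ᵇ j then + 1 else + 0)

-- exponent action of s_j (1-based): exchange the exponents of x_j and x_{j+1}
swapExp : ∀ {n} → ℕ → Exp n → Exp n
swapExp (suc zero) (a ∷ b ∷ v) = b ∷ a ∷ v
swapExp (suc (suc k)) (a ∷ v) = a ∷ swapExp (suc k) v
swapExp _ v = v

-- Laurent polynomials in x_1,…,x_n over a commutative ring R,
-- represented as finite formal sums of terms (coefficient, exponent vector);
-- two representations are equal (≋) iff all their coefficients agree.
module Laurent {c ℓ} (R : CommutativeRing c ℓ) (n : ℕ) where
  open CommutativeRing R renaming (Carrier to K)

  LPoly : Set c
  LPoly = List (K × Exp n)

  coeff : LPoly → Exp n → K
  coeff [] e = 0#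
  coeff ((a , m) ∷ p) e with ≡-dec ℤ._≟_ m e
  ... | yes _ = a + coeff p e
  ... | no _ = coeff p e

  infix 4 _≋_
  _≋_ : LPoly → LPoly → Set ℓ
  p ≋ q = ∀ e → coeff p e ≈ coeff q e

  zeroP : LPoly
  zeroP = []

  infixl 6 _⊕_ _⊖_
  infixl 7 _⊗_ _·_

  _⊕_ : LPoly → LPoly → LPoly
  p ⊕ q = p ++ q

  _·_ : K → LPoly → LPoly
  k · p = List.map (λ { (a , m) → (k * a , m) }) p

  negP : LPoly → LPoly
  negP p = List.map (λ { (a , m) → (- a , m) }) p

  _⊖_ : LPoly → LPoly → LPoly
  p ⊖ q = p ++ negP q

  _⊗_ : LPoly → LPoly → LPoly
  p ⊗ q = List.concatMap
            (λ { (a , m) → List.map (λ { (b , m′) → (a * b , Vec.zipWith ℤ._+_ m m′) }) q }) p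

  monomial : Exp n → LPoly
  monomial e = (1# , e) ∷ []

  oneP : LPoly
  oneP = monomial (Vec.replicate n (+ 0))

  xv : ℕ → LPoly
  xv j = monomial (unitExp n j)

  sw : ℕ → LPoly → LPoly
  sw j p = List.map (λ { (a , m) → (a , swapExp j m) }) p

  revInv : LPoly → LPoly
  revInv p = List.map (λ { (a , m) → (a , Vec.reverse (Vec.map ℤ.-_ m)) }) p

  CT : LPoly → K
  CT p = coeff p (Vec.replicate n (+ 0))

  -- ∏_{1≤j<k≤n} (1 - x_j x_k^{-1})
  pairs : List (Fin n × Fin n)
  pairs = List.concatMap (λ j → List.map (λ k → (j , k))
            (List.filterᵇ (λ k → toℕ j <ᵇ toℕ k) (List.allFin n))) (List.allFin n)

  factor : Fin n × Fin n → LPoly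
  factor (j , k) = oneP ⊖ monomial (Vec.zipWith ℤ._-_ (unitExp n (suc (toℕ j)))
                                                       (unitExp n (suc (toℕ k))))

  Δ : LPoly
  Δ = List.foldr (λ jk acc → factor jk ⊗ acc) oneP pairs

  pairA : LPoly → LPoly → K
  pairA f g = CT (f ⊗ revInv g ⊗ Δ)

  -- h = f π_j, i.e. h (x_j - x_{j+1}) = x_j f - x_{j+1} f^{s_j}
  -- (the quotient is unique since the Laurent polynomial ring is a domain
  --  when R is; stated as the defining equation)
  IsPi : ℕ → LPoly → LPoly → Set ℓ
  IsPi j f h = h ⊗ (xv j ⊖ xv (suc j)) ≋ xv j ⊗ f ⊖ xv (suc j) ⊗ sw j f

  IsPiHat : ℕ → LPoly → LPoly → Set (c ⊔ ℓ)
  IsPiHat j f h = Σ LPoly (λ p → IsPi j f p × h ≋ p ⊖ f)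

  record IsSubspace {v} (V : LPoly → Set v) : Set (c ⊔ ℓ ⊔ v) where
    field
      respects : ∀ {p q} → p ≋ q → V p → V q
      has-zero : V zeroP
      closed-+ : ∀ {p q} → V p → V q → V (p ⊕ q)
      closed-· : ∀ k {p} → V p → V (k · p)

{-# OPTIONS --safe #-}
module Submission where

-- Write k = n - i and F = 1 - x_k x_{k+1}⁻¹. Splitting F off the kernel ∏_{j<l} (1 - x_j x_l⁻¹)
-- leaves a product Δ′ that is symmetric in x_k and x_{k+1}, so s_k is self-adjoint for
-- ⟪u , v⟫ = CT (u v Δ′). If h = f π_k then h F = f^{s_k} - (x_k x_{k+1}⁻¹) f. The substitution
-- g ↦ g(x_n⁻¹,…,x_1⁻¹) sends x_i, x_{i+1}, s_i to x_{k+1}⁻¹, x_k⁻¹, s_k, so the image P of p = g π_i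
-- satisfies likewise P F = G^{s_k} - (x_k x_{k+1}⁻¹) G for the image G of g. Hence
-- (f π_k , g)^A = ⟪h F , G⟫ = ⟪f , P F⟫ = (f , g π_i)^A, and (f , g π̂_i)^A = (f π_k , g)^A - (f , g)^A.
-- Both claims follow from this identity: f π_k always exists (the divided difference of a monomial is
-- a geometric sum), and π_k is idempotent because x_k - x_{k+1} is not a zero divisor, which forces
-- f π_k to be s_k-symmetric.

open import Defs
open import Algebra.Bundles using (AbelianGroup; CommutativeMonoid; CommutativeRing; Monoid)
open import Algebra.Structures using (IsAbelianGroup; IsCommutativeRing)
import Algebra.Properties.CommutativeSemigroup
import Algebra.Properties.Ring
open import Data.Bool using (Bool; true; false; if_then_else_; _∧_)
open import Data.Bool.Properties using (T-≡; ∧-comm)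
open import Data.Fin as Fin using (Fin; toℕ; inject₁; opposite; fromℕ<)
import Data.Fin.Properties as Finₚ
import Data.Fin.Permutation as Perm
open import Data.Fin.Permutation using (_⟨$⟩ʳ_)
import Data.Fin.Permutation.Components as PC
open import Data.Integer as ℤ using (ℤ; +_; -[1+_])
import Data.Integer.Properties as ℤₚ
open import Data.Integer.Tactic.RingSolver using (solve-∀)
open import Data.List as List using (List; []; _∷_; _++_)
import Data.List.Properties as Listₚ
open import Data.Nat as ℕ using (ℕ; zero; suc; _<_; _≤_; _∸_; z≤n; s≤s)
import Data.Nat.Properties as ℕₚ
open import Data.Product using (_×_; _,_; proj₁; proj₂; Σ)
open import Data.Vec as Vec using (Vec; lookup; _∷ʳ_)
import Data.Vec.Properties as Vecₚ
open import Function using (_∘_; id; Equivalence)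
import Relation.Binary.PropositionalEquality as ≡
open ≡ using (_≡_; _≢_)
import Relation.Binary.Reasoning.Setoid
open import Relation.Nullary using (¬_; yes; no; does; contradiction)
open import Relation.Nullary.Decidable using (dec-true; dec-false)

module FinProperties where

  open ≡

  private
    variable
      m : ℕ

  toℕ-≡ᵇ : ∀ (x y : Fin m) → (toℕ x ℕ.≡ᵇ toℕ y) ≡ does (x Fin.≟ y)
  toℕ-≡ᵇ Fin.zero    Fin.zero    = refl
  toℕ-≡ᵇ Fin.zero    (Fin.suc y) = refl
  toℕ-≡ᵇ (Fin.suc x) Fin.zero    = refl
  toℕ-≡ᵇ (Fin.suc x) (Fin.suc y) = toℕ-≡ᵇ x y

  transpose-matchˡ : ∀ (i j : Fin m) → PC.transpose i j i ≡ j
  transpose-matchˡ i j rewrite dec-true (i Fin.≟ i) refl = refl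

  transpose-matchʳ : ∀ (i j : Fin m) → PC.transpose i j j ≡ i
  transpose-matchʳ i j with j Fin.≟ i
  ... | yes j≡i = j≡i
  ... | no _ rewrite dec-true (j Fin.≟ j) refl = refl

  transpose-other : ∀ {i j k : Fin m} → k ≢ i → k ≢ j → PC.transpose i j k ≡ k
  transpose-other {i = i} {j} {k} k≢i k≢j
    rewrite dec-false (k Fin.≟ i) k≢i | dec-false (k Fin.≟ j) k≢j = refl

  data TranspositionView (i j k : Fin m) : Set where
    at-i      : k ≡ i → TranspositionView i j k
    at-j      : k ≡ j → TranspositionView i j k
    elsewhere : k ≢ i → k ≢ j → TranspositionView i j k

  transpositionView : ∀ (i j k : Fin m) → TranspositionView i j k
  transpositionView i j k with k Fin.≟ i | k Fin.≟ j
  ... | yes k≡i | _       = at-i k≡i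
  ... | no _    | yes k≡j = at-j k≡j
  ... | no k≢i  | no k≢j  = elsewhere k≢i k≢j

  transpose-comm : ∀ (i j k : Fin m) → PC.transpose i j k ≡ PC.transpose j i k
  transpose-comm i j k with transpositionView i j k
  ... | at-i refl         = trans (transpose-matchˡ i j) (sym (transpose-matchʳ j i))
  ... | at-j refl         = trans (transpose-matchʳ i j) (sym (transpose-matchˡ j i))
  ... | elsewhere k≢i k≢j = trans (transpose-other k≢i k≢j) (sym (transpose-other k≢j k≢i))

  transpose-involutive : ∀ (i j k : Fin m) → PC.transpose i j (PC.transpose i j k) ≡ k
  transpose-involutive i j k = trans (cong (PC.transpose i j) (transpose-comm i j k)) (PC.transpose-inverse i j)

  transpose-conjugate : ∀ {n} (σ : Fin m → Fin n) → (∀ {x y} → σ x ≡ σ y → x ≡ y) →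
                        ∀ i j k → σ (PC.transpose i j k) ≡ PC.transpose (σ i) (σ j) (σ k)
  transpose-conjugate σ σ-injective i j k with transpositionView i j k
  ... | at-i refl         = trans (cong σ (transpose-matchˡ i j)) (sym (transpose-matchˡ (σ i) (σ j)))
  ... | at-j refl         = trans (cong σ (transpose-matchʳ i j)) (sym (transpose-matchʳ (σ i) (σ j)))
  ... | elsewhere k≢i k≢j =
    trans (cong σ (transpose-other k≢i k≢j))
          (sym (transpose-other (k≢i ∘ σ-injective) (k≢j ∘ σ-injective)))

  opposite-suc≡inject₁ : ∀ (j : Fin m) → opposite (Fin.suc j) ≡ inject₁ (opposite j)
  opposite-suc≡inject₁ j =
    Finₚ.toℕ-injective (trans (Finₚ.opposite-suc j) (sym (Finₚ.toℕ-inject₁ (opposite j))))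

  opposite-inject₁ : ∀ (j : Fin m) → opposite (inject₁ j) ≡ Fin.suc (opposite j)
  opposite-inject₁ j = begin
    opposite (inject₁ j)                            ≡⟨ cong (opposite ∘ inject₁) (sym (Finₚ.opposite-involutive j)) ⟩
    opposite (inject₁ (opposite (opposite j)))      ≡⟨ cong opposite (sym (opposite-suc≡inject₁ (opposite j))) ⟩
    opposite (opposite (Fin.suc (opposite j)))      ≡⟨ Finₚ.opposite-involutive _ ⟩
    Fin.suc (opposite j)                            ∎
    where open ≡-Reasoning

  adjacentSwap : Fin m → Perm.Permutation′ (suc m)
  adjacentSwap j = Perm.transpose (inject₁ j) (Fin.suc j)

  opposite-adjacentSwap : ∀ (j : Fin m) x →
                          opposite (adjacentSwap (opposite j) ⟨$⟩ʳ x) ≡ adjacentSwap j ⟨$⟩ʳ opposite x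
  opposite-adjacentSwap j x = begin
    opposite (PC.transpose (inject₁ (opposite j)) (Fin.suc (opposite j)) x)
      ≡⟨ transpose-conjugate opposite opposite-injective _ _ x ⟩
    PC.transpose (opposite (inject₁ (opposite j))) (opposite (Fin.suc (opposite j))) (opposite x)
      ≡⟨ cong₂ (λ a b → PC.transpose a b (opposite x)) (opposite-inject₁ (opposite j)) (opposite-suc≡inject₁ (opposite j)) ⟩
    PC.transpose (Fin.suc (opposite (opposite j))) (inject₁ (opposite (opposite j))) (opposite x)
      ≡⟨ cong (λ a → PC.transpose (Fin.suc a) (inject₁ a) (opposite x)) (Finₚ.opposite-involutive j) ⟩
    PC.transpose (Fin.suc j) (inject₁ j) (opposite x)
      ≡⟨ transpose-comm (Fin.suc j) (inject₁ j) (opposite x) ⟩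
    PC.transpose (inject₁ j) (Fin.suc j) (opposite x) ∎
    where
    open ≡-Reasoning
    opposite-injective : ∀ {x y : Fin (suc _)} → opposite x ≡ opposite y → x ≡ y
    opposite-injective {x} {y} eq =
      trans (sym (Finₚ.opposite-involutive x)) (trans (cong opposite eq) (Finₚ.opposite-involutive y))

open FinProperties

module VecProperties where

  open ≡
  open import Data.Vec using ([]; _∷_)

  private
    variable
      m : ℕ

  ≡-by-lookup : ∀ {a} {A : Set a} {u v : Vec A m} → (∀ x → lookup u x ≡ lookup v x) → u ≡ v
  ≡-by-lookup {u = u} {v} eq =
    trans (sym (Vecₚ.tabulate∘lookup u)) (trans (Vecₚ.tabulate-cong eq) (Vecₚ.tabulate∘lookup v))

  lookup-∷ʳ-last : ∀ {a} {A : Set a} (v : Vec A m) y → lookup (v ∷ʳ y) (Fin.fromℕ m) ≡ y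
  lookup-∷ʳ-last []      y = refl
  lookup-∷ʳ-last (x ∷ v) y = lookup-∷ʳ-last v y

  lookup-∷ʳ-inject₁ : ∀ {a} {A : Set a} (v : Vec A m) y i → lookup (v ∷ʳ y) (inject₁ i) ≡ lookup v i
  lookup-∷ʳ-inject₁ (x ∷ v) y Fin.zero    = refl
  lookup-∷ʳ-inject₁ (x ∷ v) y (Fin.suc i) = lookup-∷ʳ-inject₁ v y i

  lookup-reverse-opposite : ∀ {a} {A : Set a} (v : Vec A m) i → lookup (Vec.reverse v) (opposite i) ≡ lookup v i
  lookup-reverse-opposite {m = suc m} (x ∷ v) Fin.zero =
    trans (cong (λ w → lookup w (Fin.fromℕ m)) (Vecₚ.reverse-∷ x v)) (lookup-∷ʳ-last (Vec.reverse v) x)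
  lookup-reverse-opposite {m = suc m} (x ∷ v) (Fin.suc i) =
    trans (cong (λ w → lookup w (inject₁ (opposite i))) (Vecₚ.reverse-∷ x v))
          (trans (lookup-∷ʳ-inject₁ (Vec.reverse v) x (opposite i)) (lookup-reverse-opposite v i))

  lookup-reverse : ∀ {a} {A : Set a} (v : Vec A m) i → lookup (Vec.reverse v) i ≡ lookup v (opposite i)
  lookup-reverse v i =
    trans (cong (lookup (Vec.reverse v)) (sym (Finₚ.opposite-involutive i))) (lookup-reverse-opposite v (opposite i))

open VecProperties

module Exponents where

  open ≡
  open import Data.Vec using ([]; _∷_)

  private
    variable
      m : ℕ

    [x+y]-x≡y : ∀ x y → x ℤ.+ y ℤ.- x ≡ y
    [x+y]-x≡y = solve-∀

    x+[y-x]≡y : ∀ x y → x ℤ.+ (y ℤ.- x) ≡ y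
    x+[y-x]≡y = solve-∀

    [x+y]-y≡x : ∀ x y → x ℤ.+ y ℤ.- y ≡ x
    [x+y]-y≡x = solve-∀

    [x+y]-z≡x+[y-z] : ∀ x y z → x ℤ.+ y ℤ.- z ≡ x ℤ.+ (y ℤ.- z)
    [x+y]-z≡x+[y-z] = solve-∀

    [x-y]+[y-x]≡0 : ∀ x y → (x ℤ.- y) ℤ.+ (y ℤ.- x) ≡ + 0
    [x-y]+[y-x]≡0 = solve-∀

    y≡y+n+n[0-1] : ∀ y n → y ≡ (y ℤ.+ n) ℤ.+ n ℤ.* (+ 0 ℤ.- + 1)
    y≡y+n+n[0-1] = solve-∀

    y+n≡y+n[1-0] : ∀ y n → y ℤ.+ n ≡ y ℤ.+ n ℤ.* (+ 1 ℤ.- + 0)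
    y+n≡y+n[1-0] = solve-∀

    y≡y+n[0-0] : ∀ y n → y ≡ y ℤ.+ n ℤ.* (+ 0 ℤ.- + 0)
    y≡y+n[0-0] = solve-∀

  infixl 6 _+ᵉ_ _-ᵉ_
  infix 8 -ᵉ_

  _+ᵉ_ _-ᵉ_ : Exp m → Exp m → Exp m
  _+ᵉ_ = Vec.zipWith ℤ._+_
  _-ᵉ_ = Vec.zipWith ℤ._-_

  -ᵉ_ : Exp m → Exp m
  -ᵉ_ = Vec.map (ℤ.-_)

  0ᵉ : Exp m
  0ᵉ {m} = Vec.replicate m (+ 0)

  +ᵉ-comm : (u v : Exp m) → u +ᵉ v ≡ v +ᵉ u
  +ᵉ-comm = Vecₚ.zipWith-comm ℤₚ.+-comm

  +ᵉ-assoc : (u v w : Exp m) → (u +ᵉ v) +ᵉ w ≡ u +ᵉ (v +ᵉ w)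
  +ᵉ-assoc = Vecₚ.zipWith-assoc ℤₚ.+-assoc

  +ᵉ-identityˡ : (u : Exp m) → 0ᵉ +ᵉ u ≡ u
  +ᵉ-identityˡ = Vecₚ.zipWith-identityˡ ℤₚ.+-identityˡ

  +ᵉ-identityʳ : (u : Exp m) → u +ᵉ 0ᵉ ≡ u
  +ᵉ-identityʳ = Vecₚ.zipWith-identityʳ ℤₚ.+-identityʳ

  +ᵉ-inverseʳ : (u : Exp m) → u +ᵉ -ᵉ u ≡ 0ᵉ
  +ᵉ-inverseʳ = Vecₚ.zipWith-inverseʳ ℤₚ.+-inverseʳ

  u+[-v]≡u-v : (u v : Exp m) → u +ᵉ -ᵉ v ≡ u -ᵉ v
  u+[-v]≡u-v []      []      = refl
  u+[-v]≡u-v (x ∷ u) (y ∷ v) = cong (x ℤ.- y ∷_) (u+[-v]≡u-v u v)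

  [u+v]-u≡v : (u v : Exp m) → (u +ᵉ v) -ᵉ u ≡ v
  [u+v]-u≡v []      []      = refl
  [u+v]-u≡v (x ∷ u) (y ∷ v) = cong₂ _∷_ ([x+y]-x≡y x y) ([u+v]-u≡v u v)

  [u+v]-v≡u : (u v : Exp m) → (u +ᵉ v) -ᵉ v ≡ u
  [u+v]-v≡u []      []      = refl
  [u+v]-v≡u (x ∷ u) (y ∷ v) = cong₂ _∷_ ([x+y]-y≡x x y) ([u+v]-v≡u u v)

  [u+v]-w≡u+[v-w] : (u v w : Exp m) → (u +ᵉ v) -ᵉ w ≡ u +ᵉ (v -ᵉ w)
  [u+v]-w≡u+[v-w] []      []      []      = refl
  [u+v]-w≡u+[v-w] (x ∷ u) (y ∷ v) (z ∷ w) = cong₂ _∷_ ([x+y]-z≡x+[y-z] x y z) ([u+v]-w≡u+[v-w] u v w)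

  u+[v-u]≡v : (u v : Exp m) → u +ᵉ (v -ᵉ u) ≡ v
  u+[v-u]≡v []      []      = refl
  u+[v-u]≡v (x ∷ u) (y ∷ v) = cong₂ _∷_ (x+[y-x]≡y x y) (u+[v-u]≡v u v)

  [u-v]+[v-u]≡0ᵉ : (u v : Exp m) → (u -ᵉ v) +ᵉ (v -ᵉ u) ≡ 0ᵉ
  [u-v]+[v-u]≡0ᵉ []      []      = refl
  [u-v]+[v-u]≡0ᵉ (x ∷ u) (y ∷ v) = cong₂ _∷_ ([x-y]+[y-x]≡0 x y) ([u-v]+[v-u]≡0ᵉ u v)

  infixr 7 _⋆ᵉ_
  _⋆ᵉ_ : ℕ → Exp m → Exp m
  zero  ⋆ᵉ v = 0ᵉ
  suc N ⋆ᵉ v = v +ᵉ N ⋆ᵉ v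

  lookup-⋆ᵉ : ∀ N (v : Exp m) x → lookup (N ⋆ᵉ v) x ≡ + N ℤ.* lookup v x
  lookup-⋆ᵉ zero    v x = Vecₚ.lookup-replicate x (+ 0)
  lookup-⋆ᵉ (suc N) v x = begin
    lookup (v +ᵉ N ⋆ᵉ v) x                 ≡⟨ Vecₚ.lookup-zipWith ℤ._+_ x v (N ⋆ᵉ v) ⟩
    lookup v x ℤ.+ lookup (N ⋆ᵉ v) x       ≡⟨ cong (λ z → lookup v x ℤ.+ z) (lookup-⋆ᵉ N v x) ⟩
    lookup v x ℤ.+ + N ℤ.* lookup v x      ≡⟨ sym (ℤₚ.suc-* (+ N) (lookup v x)) ⟩
    + suc N ℤ.* lookup v x                 ∎
    where open ≡-Reasoning

  lookup-+ᵉ⋆ᵉ : ∀ (e : Exp m) N (u v : Exp m) x →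
                lookup (e +ᵉ N ⋆ᵉ (u -ᵉ v)) x ≡ lookup e x ℤ.+ + N ℤ.* (lookup u x ℤ.- lookup v x)
  lookup-+ᵉ⋆ᵉ e N u v x = begin
    lookup (e +ᵉ N ⋆ᵉ (u -ᵉ v)) x                 ≡⟨ Vecₚ.lookup-zipWith ℤ._+_ x e _ ⟩
    lookup e x ℤ.+ lookup (N ⋆ᵉ (u -ᵉ v)) x       ≡⟨ cong (λ z → lookup e x ℤ.+ z) (lookup-⋆ᵉ N _ x) ⟩
    lookup e x ℤ.+ + N ℤ.* lookup (u -ᵉ v) x      ≡⟨ cong (λ z → lookup e x ℤ.+ + N ℤ.* z) (Vecₚ.lookup-zipWith ℤ._-_ x u v) ⟩
    lookup e x ℤ.+ + N ℤ.* (lookup u x ℤ.- lookup v x) ∎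
    where open ≡-Reasoning

  swapExp-zipWith : ∀ (f : ℤ → ℤ → ℤ) k (u v : Exp m) →
                    swapExp k (Vec.zipWith f u v) ≡ Vec.zipWith f (swapExp k u) (swapExp k v)
  swapExp-zipWith f zero          u                 v                 = refl
  swapExp-zipWith f (suc zero)    []                []                = refl
  swapExp-zipWith f (suc zero)    (a ∷ [])          (b ∷ [])          = refl
  swapExp-zipWith f (suc zero)    (a ∷ a′ ∷ u)      (b ∷ b′ ∷ v)      = refl
  swapExp-zipWith f (suc (suc k)) []                []                = refl
  swapExp-zipWith f (suc (suc k)) (a ∷ u)           (b ∷ v)           =
    cong (f a b ∷_) (swapExp-zipWith f (suc k) u v)

  swapExp-involutive : ∀ k (u : Exp m) → swapExp k (swapExp k u) ≡ u
  swapExp-involutive zero          u            = refl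
  swapExp-involutive (suc zero)    []           = refl
  swapExp-involutive (suc zero)    (a ∷ [])     = refl
  swapExp-involutive (suc zero)    (a ∷ a′ ∷ u) = refl
  swapExp-involutive (suc (suc k)) []           = refl
  swapExp-involutive (suc (suc k)) (a ∷ u)      = cong (a ∷_) (swapExp-involutive (suc k) u)

  swapExp-0ᵉ : ∀ k → swapExp k (0ᵉ {m}) ≡ 0ᵉ
  swapExp-0ᵉ {m}           zero          = refl
  swapExp-0ᵉ {zero}        (suc zero)    = refl
  swapExp-0ᵉ {suc zero}    (suc zero)    = refl
  swapExp-0ᵉ {suc (suc m)} (suc zero)    = refl
  swapExp-0ᵉ {zero}        (suc (suc k)) = refl
  swapExp-0ᵉ {suc m}       (suc (suc k)) = cong (+ 0 ∷_) (swapExp-0ᵉ (suc k))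

  lookup-swapExp : ∀ (j : Fin m) (v : Exp (suc m)) x →
                   lookup (swapExp (suc (toℕ j)) v) x ≡ lookup v (adjacentSwap j ⟨$⟩ʳ x)
  lookup-swapExp Fin.zero    (a ∷ b ∷ v) Fin.zero                = refl
  lookup-swapExp Fin.zero    (a ∷ b ∷ v) (Fin.suc Fin.zero)      = refl
  lookup-swapExp Fin.zero    (a ∷ b ∷ v) (Fin.suc (Fin.suc x))   = refl
  lookup-swapExp (Fin.suc j) (a ∷ v)     Fin.zero                = refl
  lookup-swapExp (Fin.suc j) (a ∷ v)     (Fin.suc x)             =
    trans (lookup-swapExp j v x)
          (cong (lookup (a ∷ v)) (sym (Perm.lift₀-transpose (inject₁ j) (Fin.suc j) (Fin.suc x))))

  revInvᵉ : Exp m → Exp m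
  revInvᵉ v = Vec.reverse (-ᵉ v)

  lookup-revInvᵉ : ∀ (v : Exp m) x → lookup (revInvᵉ v) x ≡ ℤ.- lookup v (opposite x)
  lookup-revInvᵉ v x = trans (lookup-reverse (-ᵉ v) x) (Vecₚ.lookup-map (opposite x) ℤ.-_ v)

  revInvᵉ-involutive : (v : Exp m) → revInvᵉ (revInvᵉ v) ≡ v
  revInvᵉ-involutive v = ≡-by-lookup λ x → begin
    lookup (revInvᵉ (revInvᵉ v)) x        ≡⟨ lookup-revInvᵉ (revInvᵉ v) x ⟩
    ℤ.- lookup (revInvᵉ v) (opposite x)   ≡⟨ cong ℤ.-_ (lookup-revInvᵉ v (opposite x)) ⟩
    ℤ.- ℤ.- lookup v (opposite (opposite x)) ≡⟨ ℤₚ.neg-involutive _ ⟩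
    lookup v (opposite (opposite x))      ≡⟨ cong (lookup v) (Finₚ.opposite-involutive x) ⟩
    lookup v x                            ∎
    where open ≡-Reasoning

  revInvᵉ-+ᵉ : (u v : Exp m) → revInvᵉ (u +ᵉ v) ≡ revInvᵉ u +ᵉ revInvᵉ v
  revInvᵉ-+ᵉ u v = ≡-by-lookup λ x → begin
    lookup (revInvᵉ (u +ᵉ v)) x                        ≡⟨ lookup-revInvᵉ (u +ᵉ v) x ⟩
    ℤ.- lookup (u +ᵉ v) (opposite x)                   ≡⟨ cong ℤ.-_ (Vecₚ.lookup-zipWith ℤ._+_ (opposite x) u v) ⟩
    ℤ.- (lookup u (opposite x) ℤ.+ lookup v (opposite x)) ≡⟨ ℤₚ.neg-distrib-+ (lookup u (opposite x)) (lookup v (opposite x)) ⟩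
    ℤ.- lookup u (opposite x) ℤ.+ ℤ.- lookup v (opposite x)
      ≡⟨ sym (cong₂ ℤ._+_ (lookup-revInvᵉ u x) (lookup-revInvᵉ v x)) ⟩
    lookup (revInvᵉ u) x ℤ.+ lookup (revInvᵉ v) x      ≡⟨ sym (Vecₚ.lookup-zipWith ℤ._+_ x (revInvᵉ u) (revInvᵉ v)) ⟩
    lookup (revInvᵉ u +ᵉ revInvᵉ v) x                  ∎
    where open ≡-Reasoning

  revInvᵉ-swapExp : ∀ (j : Fin m) (v : Exp (suc m)) →
                    revInvᵉ (swapExp (suc (toℕ j)) v) ≡ swapExp (suc (toℕ (opposite j))) (revInvᵉ v)
  revInvᵉ-swapExp j v = ≡-by-lookup λ x → begin
    lookup (revInvᵉ (swapExp k v)) x              ≡⟨ lookup-revInvᵉ (swapExp k v) x ⟩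
    ℤ.- lookup (swapExp k v) (opposite x)         ≡⟨ cong ℤ.-_ (lookup-swapExp j v (opposite x)) ⟩
    ℤ.- lookup v (τ (opposite x))                 ≡⟨ cong (ℤ.-_ ∘ lookup v) (opposite-adjacentSwap j x) ⟨
    ℤ.- lookup v (opposite (τ′ x))                ≡⟨ lookup-revInvᵉ v (τ′ x) ⟨
    lookup (revInvᵉ v) (τ′ x)                     ≡⟨ lookup-swapExp (opposite j) (revInvᵉ v) x ⟨
    lookup (swapExp k′ (revInvᵉ v)) x             ∎
    where
    open ≡-Reasoning
    k k′ : ℕ
    k  = suc (toℕ j)
    k′ = suc (toℕ (opposite j))
    τ τ′ : Fin (suc _) → Fin (suc _)
    τ  = adjacentSwap j ⟨$⟩ʳ_
    τ′ = adjacentSwap (opposite j) ⟨$⟩ʳ_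

  unit : Fin m → Exp m
  unit {m} j = unitExp m (suc (toℕ j))

  lookup-unit : ∀ (j x : Fin m) → lookup (unit j) x ≡ (if does (x Fin.≟ j) then + 1 else + 0)
  lookup-unit j x =
    trans (Vecₚ.lookup∘tabulate _ x) (cong (if_then + 1 else + 0) (toℕ-≡ᵇ x j))

  lookup-unit-self : ∀ (j : Fin m) → lookup (unit j) j ≡ + 1
  lookup-unit-self j = trans (lookup-unit j j) (cong (if_then + 1 else + 0) (dec-true (j Fin.≟ j) refl))

  lookup-unit-other : ∀ {j x : Fin m} → x ≢ j → lookup (unit j) x ≡ + 0
  lookup-unit-other {j = j} {x} x≢j = trans (lookup-unit j x) (cong (if_then + 1 else + 0) (dec-false (x Fin.≟ j) x≢j))

  lookup-unit-involution : ∀ (σ : Fin m → Fin m) → (∀ x → σ (σ x) ≡ x) →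
                           ∀ j x → lookup (unit j) (σ x) ≡ lookup (unit (σ j)) x
  lookup-unit-involution σ σ-involutive j x with x Fin.≟ σ j
  ... | yes refl = trans (cong (lookup (unit j)) (σ-involutive j)) (trans (lookup-unit-self j) (sym (lookup-unit-self (σ j))))
  ... | no x≢σj  = trans (lookup-unit-other σx≢j) (sym (lookup-unit-other x≢σj))
    where
    σx≢j : σ x ≢ j
    σx≢j σx≡j = x≢σj (trans (sym (σ-involutive x)) (cong σ σx≡j))

  unit-inject₁ : ∀ (j : Fin m) → unitExp (suc m) (suc (toℕ j)) ≡ unit (inject₁ j)
  unit-inject₁ {m} j = cong (λ i → unitExp (suc m) (suc i)) (sym (Finₚ.toℕ-inject₁ j))

  swapExp-unit : ∀ (j : Fin m) x → swapExp (suc (toℕ j)) (unit x) ≡ unit (adjacentSwap j ⟨$⟩ʳ x)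
  swapExp-unit j x = ≡-by-lookup λ y →
    trans (lookup-swapExp j (unit x) y)
          (lookup-unit-involution (adjacentSwap j ⟨$⟩ʳ_) (transpose-involutive (inject₁ j) (Fin.suc j)) x y)

  revInvᵉ-unit : ∀ (x : Fin m) → revInvᵉ (unit x) ≡ -ᵉ unit (opposite x)
  revInvᵉ-unit x = ≡-by-lookup λ y → begin
    lookup (revInvᵉ (unit x)) y           ≡⟨ lookup-revInvᵉ (unit x) y ⟩
    ℤ.- lookup (unit x) (opposite y)      ≡⟨ cong ℤ.-_ (lookup-unit-involution opposite Finₚ.opposite-involutive x y) ⟩
    ℤ.- lookup (unit (opposite x)) y      ≡⟨ sym (Vecₚ.lookup-map y ℤ.-_ (unit (opposite x))) ⟩
    lookup (-ᵉ unit (opposite x)) y       ∎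
    where open ≡-Reasoning

  transpose-shift : ∀ {i j : Fin m} (e : Exp m) N → i ≢ j → lookup e i ≡ lookup e j ℤ.+ + N →
                    ∀ x → lookup e (PC.transpose i j x) ≡ lookup (e +ᵉ N ⋆ᵉ (unit j -ᵉ unit i)) x
  transpose-shift {i = i} {j} e N i≢j eᵢ≡eⱼ+N x with transpositionView i j x
  ... | at-i refl
    rewrite lookup-+ᵉ⋆ᵉ e N (unit j) (unit i) i | transpose-matchˡ i j
          | lookup-unit-other i≢j | lookup-unit-self i | eᵢ≡eⱼ+N = y≡y+n+n[0-1] (lookup e j) (+ N)
  ... | at-j refl
    rewrite lookup-+ᵉ⋆ᵉ e N (unit j) (unit i) j | transpose-matchʳ i j
          | lookup-unit-self j | lookup-unit-other (i≢j ∘ sym) | eᵢ≡eⱼ+N = y+n≡y+n[1-0] (lookup e j) (+ N)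
  ... | elsewhere x≢i x≢j
    rewrite lookup-+ᵉ⋆ᵉ e N (unit j) (unit i) x | transpose-other x≢i x≢j
          | lookup-unit-other x≢j | lookup-unit-other x≢i = y≡y+n[0-0] (lookup e x) (+ N)

open Exponents

module CommutativeRingIdentities {c ℓ} (R : CommutativeRing c ℓ) where

  open CommutativeRing R
  open import Algebra.Properties.Semiring.Exp semiring public using (_^_)
  open import Algebra.Properties.Ring ring using (-‿distribˡ-*; -‿distribʳ-*; x[y-z]≈xy-xz; [y-z]x≈yx-zx)
  open import Algebra.Properties.AbelianGroup +-abelianGroup using (⁻¹-anti-homo‿-; ⁻¹-∙-comm)
  open import Algebra.Properties.CommutativeSemigroup +-commutativeSemigroup using () renaming (interchange to +-interchange)
  open import Algebra.Properties.CommutativeSemigroup *-commutativeSemigroup using (interchange; xy∙z≈xz∙y)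
  open import Relation.Binary.Reasoning.Setoid setoid

  [x-y]+[y-z]≈x-z : ∀ x y z → (x - y) + (y - z) ≈ x - z
  [x-y]+[y-z]≈x-z x y z = begin
    (x - y) + (y - z)    ≈⟨ +-assoc x (- y) (y - z) ⟩
    x + (- y + (y - z))  ≈⟨ +-congˡ (+-assoc (- y) y (- z)) ⟨
    x + ((- y + y) - z)  ≈⟨ +-congˡ (+-congʳ (-‿inverseˡ y)) ⟩
    x + (0# - z)         ≈⟨ +-congˡ (+-identityˡ (- z)) ⟩
    x - z                ∎

  [x-y]+[z-w]≈[x+z]-[y+w] : ∀ x y z w → (x - y) + (z - w) ≈ (x + z) - (y + w)
  [x-y]+[z-w]≈[x+z]-[y+w] x y z w = trans (+-interchange x (- y) z (- w)) (+-congˡ (⁻¹-∙-comm y w))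

  geometric : ℕ → Carrier → Carrier
  geometric zero    t = 0#
  geometric (suc N) t = 1# + t * geometric N t

  geometric-telescope : ∀ N t → geometric N t * (1# - t) ≈ 1# - t ^ N
  geometric-telescope zero    t = trans (zeroˡ (1# - t)) (sym (-‿inverseʳ 1#))
  geometric-telescope (suc N) t = begin
    (1# + t * G) * (1# - t)              ≈⟨ distribʳ (1# - t) 1# (t * G) ⟩
    1# * (1# - t) + (t * G) * (1# - t)   ≈⟨ +-cong (*-identityˡ (1# - t)) (*-assoc t G (1# - t)) ⟩
    (1# - t) + t * (G * (1# - t))        ≈⟨ +-congˡ (*-congˡ (geometric-telescope N t)) ⟩
    (1# - t) + t * (1# - t ^ N)          ≈⟨ +-congˡ (trans (x[y-z]≈xy-xz t 1# (t ^ N)) (+-congʳ (*-identityʳ t))) ⟩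
    (1# - t) + (t - t * t ^ N)           ≈⟨ [x-y]+[y-z]≈x-z 1# t (t * t ^ N) ⟩
    1# - t ^ suc N                       ∎
    where G = geometric N t

  geometric-telescope⁻ : ∀ {s t} M → s * t ≈ 1# → (- (s * geometric M s)) * (1# - t) ≈ 1# - t * s ^ suc M
  geometric-telescope⁻ {s} {t} M st≈1 = begin
    (- (s * G)) * (1# - t)      ≈⟨ -‿distribˡ-* (s * G) (1# - t) ⟨
    - ((s * G) * (1# - t))      ≈⟨ -‿cong (xy∙z≈xz∙y s G (1# - t)) ⟩
    - ((s * (1# - t)) * G)      ≈⟨ -‿cong (*-congʳ s[1-t]≈s-1) ⟩
    - ((s - 1#) * G)            ≈⟨ -‿distribˡ-* (s - 1#) G ⟩
    (- (s - 1#)) * G            ≈⟨ *-congʳ (⁻¹-anti-homo‿- s 1#) ⟩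
    (1# - s) * G                ≈⟨ *-comm (1# - s) G ⟩
    G * (1# - s)                ≈⟨ geometric-telescope M s ⟩
    1# - s ^ M                  ≈⟨ +-congˡ (-‿cong ts^[1+M]≈s^M) ⟨
    1# - t * s ^ suc M          ∎
    where
    G = geometric M s
    s[1-t]≈s-1 : s * (1# - t) ≈ s - 1#
    s[1-t]≈s-1 = trans (x[y-z]≈xy-xz s 1# t) (+-cong (*-identityʳ s) (-‿cong st≈1))
    ts^[1+M]≈s^M : t * s ^ suc M ≈ s ^ M
    ts^[1+M]≈s^M = trans (sym (*-assoc t s (s ^ M)))
                         (trans (*-congʳ (trans (*-comm t s) st≈1)) (*-identityˡ (s ^ M)))

  divided-difference-of-multiple : ∀ {q q′ u w t τ H} →
    H * (1# - t) ≈ 1# - t * τ → q′ ≈ q * τ → w ≈ u * t → (q * H) * (u - w) ≈ u * q - w * q′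
  divided-difference-of-multiple {q} {q′} {u} {w} {t} {τ} {H} H[1-t]≈ q′≈qτ w≈ut = begin
    (q * H) * (u - w)                  ≈⟨ *-congˡ (+-congˡ (-‿cong w≈ut)) ⟩
    (q * H) * (u - u * t)              ≈⟨ *-congˡ u[1-t]≈u-ut ⟨
    (q * H) * (u * (1# - t))           ≈⟨ interchange q H u (1# - t) ⟩
    (q * u) * (H * (1# - t))           ≈⟨ *-congˡ H[1-t]≈ ⟩
    (q * u) * (1# - t * τ)             ≈⟨ x[y-z]≈xy-xz (q * u) 1# (t * τ) ⟩
    (q * u) * 1# - (q * u) * (t * τ)   ≈⟨ +-cong (*-identityʳ (q * u)) (-‿cong (*-congʳ (*-comm q u))) ⟩
    q * u - (u * q) * (t * τ)          ≈⟨ +-cong (*-comm q u) (-‿cong (interchange u q t τ)) ⟩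
    u * q - (u * t) * (q * τ)          ≈⟨ +-congˡ (-‿cong (*-cong (sym w≈ut) (sym q′≈qτ))) ⟩
    u * q - w * q′                     ∎
    where
    u[1-t]≈u-ut : u * (1# - t) ≈ u - u * t
    u[1-t]≈u-ut = trans (x[y-z]≈xy-xz u 1# t) (+-congʳ (*-identityʳ u))

  divided-difference-rescale : ∀ {r u v q q′ w m} →
    r * (u - v) ≈ u * q - v * q′ → v * w ≈ 1# → u * w ≈ m → r * (1# - m) ≈ q′ - m * q
  divided-difference-rescale {r} {u} {v} {q} {q′} {w} {m} r[u-v]≈ vw≈1 uw≈m = begin
    r * (1# - m)                 ≈⟨ *-congˡ (+-cong (sym vw≈1) (-‿cong (sym uw≈m))) ⟩
    r * (v * w - u * w)          ≈⟨ *-congˡ ([y-z]x≈yx-zx w v u) ⟨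
    r * ((v - u) * w)            ≈⟨ *-assoc r (v - u) w ⟨
    (r * (v - u)) * w            ≈⟨ *-congʳ (*-congˡ (⁻¹-anti-homo‿- u v)) ⟨
    (r * - (u - v)) * w          ≈⟨ *-congʳ (-‿distribʳ-* r (u - v)) ⟨
    (- (r * (u - v))) * w        ≈⟨ *-congʳ (-‿cong r[u-v]≈) ⟩
    (- (u * q - v * q′)) * w     ≈⟨ *-congʳ (⁻¹-anti-homo‿- (u * q) (v * q′)) ⟩
    (v * q′ - u * q) * w         ≈⟨ [y-z]x≈yx-zx w (v * q′) (u * q) ⟩
    (v * q′) * w - (u * q) * w   ≈⟨ +-cong (xy∙z≈xz∙y v q′ w) (-‿cong (xy∙z≈xz∙y u q w)) ⟩
    (v * w) * q′ - (u * w) * q   ≈⟨ +-cong (trans (*-congʳ vw≈1) (*-identityˡ q′)) (-‿cong (*-congʳ uw≈m)) ⟩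
    q′ - m * q                   ∎

module ListSums {c ℓ} (M : Monoid c ℓ) where

  open Monoid M
  open import Algebra.Properties.Monoid.Sum M using (sum)

  sumˡ : ∀ {a} {A : Set a} → (A → Carrier) → List A → Carrier
  sumˡ φ = List.foldr (λ x acc → φ x ∙ acc) ε

  module _ {a} {A : Set a} (φ : A → Carrier) where

    sumˡ-cong : ∀ {ψ : A → Carrier} → (∀ x → φ x ≈ ψ x) → ∀ xs → sumˡ φ xs ≈ sumˡ ψ xs
    sumˡ-cong φ≈ψ []       = refl
    sumˡ-cong φ≈ψ (x ∷ xs) = ∙-cong (φ≈ψ x) (sumˡ-cong φ≈ψ xs)

    sumˡ-++ : ∀ xs ys → sumˡ φ (xs ++ ys) ≈ sumˡ φ xs ∙ sumˡ φ ys
    sumˡ-++ []       ys = sym (identityˡ (sumˡ φ ys))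
    sumˡ-++ (x ∷ xs) ys = trans (∙-congˡ (sumˡ-++ xs ys)) (sym (assoc (φ x) (sumˡ φ xs) (sumˡ φ ys)))

    sumˡ-concatMap : ∀ {b} {B : Set b} (g : B → List A) xs → sumˡ φ (List.concatMap g xs) ≈ sumˡ (sumˡ φ ∘ g) xs
    sumˡ-concatMap g []       = refl
    sumˡ-concatMap g (x ∷ xs) = trans (sumˡ-++ (g x) (List.concatMap g xs)) (∙-congˡ (sumˡ-concatMap g xs))

    sumˡ-map : ∀ {b} {B : Set b} (h : B → A) xs → sumˡ φ (List.map h xs) ≡ sumˡ (φ ∘ h) xs
    sumˡ-map h []       = ≡.refl
    sumˡ-map h (x ∷ xs) = ≡.cong (φ (h x) ∙_) (sumˡ-map h xs)

    sumˡ-filterᵇ : ∀ (p : A → Bool) xs → sumˡ φ (List.filterᵇ p xs) ≈ sumˡ (λ x → if p x then φ x else ε) xs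
    sumˡ-filterᵇ p []       = refl
    sumˡ-filterᵇ p (x ∷ xs) with p x
    ... | true  = ∙-congˡ (sumˡ-filterᵇ p xs)
    ... | false = trans (sumˡ-filterᵇ p xs) (sym (identityˡ _))

    sumˡ-tabulate : ∀ {n} (f : Fin n → A) → sumˡ φ (List.tabulate f) ≡ sum (φ ∘ f)
    sumˡ-tabulate {zero}  f = ≡.refl
    sumˡ-tabulate {suc n} f = ≡.cong (φ (f Fin.zero) ∙_) (sumˡ-tabulate (f ∘ Fin.suc))

module FinSums {c ℓ} (M : CommutativeMonoid c ℓ) where

  open CommutativeMonoid M
  open import Algebra.Properties.CommutativeMonoid.Sum M using (sum; sum-cong-≋)
  open import Algebra.Properties.CommutativeSemigroup commutativeSemigroup using (x∙yz≈y∙xz)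

  sum-pull : ∀ {n} (p : Fin n) {f g : Fin n → Carrier} z →
             (∀ x → x ≢ p → f x ≈ g x) → f p ≈ z ∙ g p → sum f ≈ z ∙ sum g
  sum-pull Fin.zero    z f≈g fp≈zgp =
    trans (∙-cong fp≈zgp (sum-cong-≋ λ x → f≈g (Fin.suc x) λ ())) (assoc z _ _)
  sum-pull (Fin.suc p) z f≈g fp≈zgp =
    trans (∙-cong (f≈g Fin.zero λ ()) (sum-pull p z (λ x x≢p → f≈g (Fin.suc x) (x≢p ∘ Finₚ.suc-injective)) fp≈zgp))
          (x∙yz≈y∙xz _ z _)

module LaurentRing {c ℓ} (R : CommutativeRing c ℓ) (n : ℕ) where

  open CommutativeRing R renaming (Carrier to K)
  open Laurent R n
  open import Algebra.Properties.Ring ring using (-0#≈0#)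
  open import Algebra.Properties.AbelianGroup +-abelianGroup using (⁻¹-∙-comm)
  module ≈-Reasoning = Relation.Binary.Reasoning.Setoid setoid

  -- `p ≋ q` unfolds to a Π-type from which neither p nor q can be inferred; the record keeps them visible.
  infix 4 _≃_
  record _≃_ (p q : LPoly) : Set ℓ where
    constructor ≋⇒≃
    field ≃⇒≋ : p ≋ q
  open _≃_ public

  ≃-refl : ∀ {p} → p ≃ p
  ≃-refl = ≋⇒≃ λ _ → refl

  ≃-sym : ∀ {p q} → p ≃ q → q ≃ p
  ≃-sym (≋⇒≃ eq) = ≋⇒≃ λ e → sym (eq e)

  ≃-trans : ∀ {p q r} → p ≃ q → q ≃ r → p ≃ r
  ≃-trans (≋⇒≃ eq) (≋⇒≃ eq′) = ≋⇒≃ λ e → trans (eq e) (eq′ e)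

  ≡⇒≃ : ∀ {p q} → p ≡ q → p ≃ q
  ≡⇒≃ ≡.refl = ≃-refl

  ∷-cong : ∀ {a b m m′ p q} → a ≈ b → m ≡ m′ → p ≃ q → (a , m) ∷ p ≃ (b , m′) ∷ q
  ∷-cong {a} {b} {m} {p = p} {q} a≈b ≡.refl (≋⇒≃ p≋q) = ≋⇒≃ pointwise
    where
    pointwise : ∀ e → coeff ((a , m) ∷ p) e ≈ coeff ((b , m) ∷ q) e
    pointwise e with Vecₚ.≡-dec ℤ._≟_ m e
    ... | yes _ = +-cong a≈b (p≋q e)
    ... | no _  = p≋q e

  coeff-∷-≢ : ∀ {a m p e} → m ≢ e → coeff ((a , m) ∷ p) e ≈ coeff p e
  coeff-∷-≢ {m = m} {e = e} m≢e with Vecₚ.≡-dec ℤ._≟_ m e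
  ... | yes m≡e = contradiction m≡e m≢e
  ... | no _    = refl

  coeff-++ : ∀ p q e → coeff (p ++ q) e ≈ coeff p e + coeff q e
  coeff-++ []            q e = sym (+-identityˡ _)
  coeff-++ ((a , m) ∷ p) q e with Vecₚ.≡-dec ℤ._≟_ m e
  ... | yes _ = trans (+-congˡ (coeff-++ p q e)) (sym (+-assoc _ _ _))
  ... | no _  = coeff-++ p q e

  coeff-negP : ∀ p e → coeff (negP p) e ≈ - coeff p e
  coeff-negP []            e = sym -0#≈0#
  coeff-negP ((a , m) ∷ p) e with Vecₚ.≡-dec ℤ._≟_ m e
  ... | yes _ = trans (+-congˡ (coeff-negP p e)) (⁻¹-∙-comm a (coeff p e))
  ... | no _  = coeff-negP p e

  ++-cong : ∀ {p p′ q q′} → p ≃ p′ → q ≃ q′ → p ++ q ≃ p′ ++ q′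
  ++-cong {p} {p′} {q} {q′} (≋⇒≃ p≋p′) (≋⇒≃ q≋q′) = ≋⇒≃ λ e → begin
    coeff (p ++ q) e          ≈⟨ coeff-++ p q e ⟩
    coeff p e + coeff q e     ≈⟨ +-cong (p≋p′ e) (q≋q′ e) ⟩
    coeff p′ e + coeff q′ e   ≈⟨ coeff-++ p′ q′ e ⟨
    coeff (p′ ++ q′) e        ∎
    where open ≈-Reasoning

  ++-comm : ∀ p q → p ++ q ≃ q ++ p
  ++-comm p q = ≋⇒≃ λ e → trans (coeff-++ p q e) (trans (+-comm _ _) (sym (coeff-++ q p e)))

  negP-cong : ∀ {p q} → p ≃ q → negP p ≃ negP q
  negP-cong {p} {q} (≋⇒≃ p≋q) = ≋⇒≃ λ e → trans (coeff-negP p e) (trans (-‿cong (p≋q e)) (sym (coeff-negP q e)))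

  ++-negP : ∀ p → p ++ negP p ≃ []
  ++-negP p = ≋⇒≃ λ e → trans (coeff-++ p (negP p) e) (trans (+-congˡ (coeff-negP p e)) (-‿inverseʳ _))

  ⊕-isAbelianGroup : IsAbelianGroup _≃_ _⊕_ zeroP negP
  ⊕-isAbelianGroup = record
    { isGroup = record
      { isMonoid = record
        { isSemigroup = record
          { isMagma = record
            { isEquivalence = record { refl = ≃-refl ; sym = ≃-sym ; trans = ≃-trans }
            ; ∙-cong        = ++-cong
            }
          ; assoc = λ p q r → ≡⇒≃ (Listₚ.++-assoc p q r)
          }
        ; identity = (λ _ → ≃-refl) , (λ p → ≡⇒≃ (Listₚ.++-identityʳ p))
        }
      ; inverse = (λ p → ≃-trans (++-comm (negP p) p) (++-negP p)) , ++-negP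
      ; ⁻¹-cong = negP-cong
      }
    ; comm = ++-comm
    }

  ⊕-abelianGroup : AbelianGroup c ℓ
  ⊕-abelianGroup = record { isAbelianGroup = ⊕-isAbelianGroup }

  open AbelianGroup ⊕-abelianGroup public
    using () renaming (setoid to ≃-setoid; commutativeSemigroup to ⊕-commutativeSemigroup)
  module ≃-Reasoning = Relation.Binary.Reasoning.Setoid ≃-setoid
  open Algebra.Properties.CommutativeSemigroup ⊕-commutativeSemigroup using () renaming (interchange to ⊕-interchange)

  infixr 7 _*ₜ_
  _*ₜ_ : K × Exp n → LPoly → LPoly
  (a , m) *ₜ q = List.map (λ { (b , m′) → (a * b , m +ᵉ m′) }) q

  coeff-*ₜ : ∀ a m q e → coeff ((a , m) *ₜ q) e ≈ a * coeff q (e -ᵉ m)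
  coeff-*ₜ a m []             e = sym (zeroʳ a)
  coeff-*ₜ a m ((b , m′) ∷ q) e with Vecₚ.≡-dec ℤ._≟_ (m +ᵉ m′) e | Vecₚ.≡-dec ℤ._≟_ m′ (e -ᵉ m)
  ... | yes _       | yes _        = trans (+-congˡ (coeff-*ₜ a m q e)) (sym (distribˡ a b _))
  ... | yes m+m′≡e  | no m′≢e-m    = contradiction (≡.trans (≡.sym ([u+v]-u≡v m m′)) (≡.cong (_-ᵉ m) m+m′≡e)) m′≢e-m
  ... | no m+m′≢e   | yes m′≡e-m   = contradiction (≡.trans (≡.cong (m +ᵉ_) m′≡e-m) (u+[v-u]≡v m e)) m+m′≢e
  ... | no _        | no _         = coeff-*ₜ a m q e

  *ₜ-congʳ : ∀ t {q q′} → q ≃ q′ → t *ₜ q ≃ t *ₜ q′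
  *ₜ-congʳ (a , m) {q} {q′} (≋⇒≃ q≋q′) = ≋⇒≃ λ e →
    trans (coeff-*ₜ a m q e) (trans (*-congˡ (q≋q′ _)) (sym (coeff-*ₜ a m q′ e)))

  *ₜ-*ₜ : ∀ a b m m′ r → (a * b , m +ᵉ m′) *ₜ r ≃ (a , m) *ₜ ((b , m′) *ₜ r)
  *ₜ-*ₜ a b m m′ []             = ≃-refl
  *ₜ-*ₜ a b m m′ ((d , m″) ∷ r) = ∷-cong (*-assoc a b d) (+ᵉ-assoc m m′ m″) (*ₜ-*ₜ a b m m′ r)

  *ₜ-identityˡ : ∀ q → (1# , 0ᵉ) *ₜ q ≃ q
  *ₜ-identityˡ []            = ≃-refl
  *ₜ-identityˡ ((b , m) ∷ q) = ∷-cong (*-identityˡ b) (+ᵉ-identityˡ m) (*ₜ-identityˡ q)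

  ⊗-zeroʳ : ∀ p → p ⊗ [] ≡ []
  ⊗-zeroʳ []      = ≡.refl
  ⊗-zeroʳ (t ∷ p) = ⊗-zeroʳ p

  *ₜ-comm : ∀ t q → t *ₜ q ≃ q ⊗ (t ∷ [])
  *ₜ-comm t             []             = ≃-refl
  *ₜ-comm t@(a , m)     ((b , m′) ∷ q) = ∷-cong (*-comm a b) (+ᵉ-comm m m′) (*ₜ-comm t q)

  ⊗-congʳ : ∀ p {q q′} → q ≃ q′ → p ⊗ q ≃ p ⊗ q′
  ⊗-congʳ []      _    = ≃-refl
  ⊗-congʳ (t ∷ p) q≃q′ = ++-cong (*ₜ-congʳ t q≃q′) (⊗-congʳ p q≃q′)

  ⊗-distribʳ : ∀ q p p′ → (p ++ p′) ⊗ q ≃ p ⊗ q ++ p′ ⊗ q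
  ⊗-distribʳ q p p′ = ≡⇒≃ (Listₚ.concatMap-++ (_*ₜ q) p p′)

  ⊗-distribˡ : ∀ p q q′ → p ⊗ (q ++ q′) ≃ p ⊗ q ++ p ⊗ q′
  ⊗-distribˡ []      q q′ = ≃-refl
  ⊗-distribˡ (t ∷ p) q q′ = begin
    t *ₜ (q ++ q′) ++ p ⊗ (q ++ q′)          ≡⟨ ≡.cong (_++ p ⊗ (q ++ q′)) (Listₚ.map-++ _ q q′) ⟩
    (t *ₜ q ++ t *ₜ q′) ++ p ⊗ (q ++ q′)     ≈⟨ ++-cong ≃-refl (⊗-distribˡ p q q′) ⟩
    (t *ₜ q ++ t *ₜ q′) ++ (p ⊗ q ++ p ⊗ q′) ≈⟨ ⊕-interchange (t *ₜ q) (t *ₜ q′) (p ⊗ q) (p ⊗ q′) ⟩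
    (t *ₜ q ++ p ⊗ q) ++ (t *ₜ q′ ++ p ⊗ q′) ∎
    where open ≃-Reasoning

  ⊗-comm : ∀ p q → p ⊗ q ≃ q ⊗ p
  ⊗-comm []      q = ≡⇒≃ (≡.sym (⊗-zeroʳ q))
  ⊗-comm (t ∷ p) q = ≃-trans (++-cong (*ₜ-comm t q) (⊗-comm p q)) (≃-sym (⊗-distribˡ q (t ∷ []) p))

  *ₜ-⊗ : ∀ t q r → (t *ₜ q) ⊗ r ≃ t *ₜ (q ⊗ r)
  *ₜ-⊗ t             []             r = ≃-refl
  *ₜ-⊗ t@(a , m)     ((b , m′) ∷ q) r = begin
    (a * b , m +ᵉ m′) *ₜ r ++ (t *ₜ q) ⊗ r      ≈⟨ ++-cong (*ₜ-*ₜ a b m m′ r) (*ₜ-⊗ t q r) ⟩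
    t *ₜ ((b , m′) *ₜ r) ++ t *ₜ (q ⊗ r)         ≡⟨ Listₚ.map-++ _ ((b , m′) *ₜ r) (q ⊗ r) ⟨
    t *ₜ ((b , m′) *ₜ r ++ q ⊗ r)                ∎
    where open ≃-Reasoning

  ⊗-assoc : ∀ p q r → (p ⊗ q) ⊗ r ≃ p ⊗ (q ⊗ r)
  ⊗-assoc []      q r = ≃-refl
  ⊗-assoc (t ∷ p) q r =
    ≃-trans (⊗-distribʳ r (t *ₜ q) (p ⊗ q)) (++-cong (*ₜ-⊗ t q r) (⊗-assoc p q r))

  ⊗-cong : ∀ {p p′ q q′} → p ≃ p′ → q ≃ q′ → p ⊗ q ≃ p′ ⊗ q′
  ⊗-cong {p} {p′} {q} {q′} p≃p′ q≃q′ =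
    ≃-trans (≃-trans (⊗-comm p q) (⊗-congʳ q p≃p′)) (≃-trans (⊗-comm q p′) (⊗-congʳ p′ q≃q′))

  ⊗-identityˡ : ∀ q → oneP ⊗ q ≃ q
  ⊗-identityˡ q = ≃-trans (≡⇒≃ (Listₚ.++-identityʳ _)) (*ₜ-identityˡ q)

  ⊕-⊗-isCommutativeRing : IsCommutativeRing _≃_ _⊕_ _⊗_ negP zeroP oneP
  ⊕-⊗-isCommutativeRing = record
    { isRing = record
      { +-isAbelianGroup = ⊕-isAbelianGroup
      ; *-cong           = ⊗-cong
      ; *-assoc          = ⊗-assoc
      ; *-identity       = ⊗-identityˡ , λ q → ≃-trans (⊗-comm q oneP) (⊗-identityˡ q)
      ; distrib          = ⊗-distribˡ , ⊗-distribʳ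
      }
    ; *-comm = ⊗-comm
    }

  ⊕-⊗-commutativeRing : CommutativeRing c ℓ
  ⊕-⊗-commutativeRing = record { isCommutativeRing = ⊕-⊗-isCommutativeRing }

  monomial-⊗ : ∀ u v → monomial u ⊗ monomial v ≃ monomial (u +ᵉ v)
  monomial-⊗ u v = ∷-cong (*-identityˡ 1#) ≡.refl ≃-refl

  term-⊗-monomial : ∀ a e w → ((a , e) ∷ []) ⊗ monomial w ≃ (a , e +ᵉ w) ∷ []
  term-⊗-monomial a e w = ∷-cong (*-identityʳ a) ≡.refl ≃-refl

  mapExp : (Exp n → Exp n) → LPoly → LPoly
  mapExp φ = List.map (λ { (a , m) → (a , φ m) })

  module _ {φ : Exp n → Exp n} (φ-involutive : ∀ v → φ (φ v) ≡ v) where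

    coeff-mapExp : ∀ p e → coeff (mapExp φ p) e ≈ coeff p (φ e)
    coeff-mapExp []            e = refl
    coeff-mapExp ((a , m) ∷ p) e with Vecₚ.≡-dec ℤ._≟_ (φ m) e | Vecₚ.≡-dec ℤ._≟_ m (φ e)
    ... | yes _     | yes _     = +-congˡ (coeff-mapExp p e)
    ... | yes φm≡e  | no m≢φe   = contradiction (≡.trans (≡.sym (φ-involutive m)) (≡.cong φ φm≡e)) m≢φe
    ... | no φm≢e   | yes m≡φe  = contradiction (≡.trans (≡.cong φ m≡φe) (φ-involutive e)) φm≢e
    ... | no _      | no _      = coeff-mapExp p e

    mapExp-cong : ∀ {p q} → p ≃ q → mapExp φ p ≃ mapExp φ q
    mapExp-cong {p} {q} (≋⇒≃ p≋q) = ≋⇒≃ λ e →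
      trans (coeff-mapExp p e) (trans (p≋q (φ e)) (sym (coeff-mapExp q e)))

  module _ {φ : Exp n → Exp n} where

    mapExp-++ : ∀ p q → mapExp φ (p ++ q) ≡ mapExp φ p ++ mapExp φ q
    mapExp-++ = Listₚ.map-++ _

    mapExp-negP : ∀ p → mapExp φ (negP p) ≡ negP (mapExp φ p)
    mapExp-negP []            = ≡.refl
    mapExp-negP ((a , m) ∷ p) = ≡.cong ((- a , φ m) ∷_) (mapExp-negP p)

    mapExp-commute : ∀ {ψ ψ′ : Exp n → Exp n} → (∀ v → φ (ψ v) ≡ ψ′ (φ v)) →
                     ∀ p → mapExp φ (mapExp ψ p) ≡ mapExp ψ′ (mapExp φ p)
    mapExp-commute φψ≡ψ′φ []            = ≡.refl
    mapExp-commute φψ≡ψ′φ ((a , m) ∷ p) = ≡.cong₂ (λ v q → (a , v) ∷ q) (φψ≡ψ′φ m) (mapExp-commute φψ≡ψ′φ p)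

    module _ (φ-+ᵉ : ∀ u v → φ (u +ᵉ v) ≡ φ u +ᵉ φ v) where

      mapExp-*ₜ : ∀ a m q → mapExp φ ((a , m) *ₜ q) ≡ (a , φ m) *ₜ mapExp φ q
      mapExp-*ₜ a m []             = ≡.refl
      mapExp-*ₜ a m ((b , m′) ∷ q) = ≡.cong₂ (λ v r → (a * b , v) ∷ r) (φ-+ᵉ m m′) (mapExp-*ₜ a m q)

      mapExp-⊗ : ∀ p q → mapExp φ (p ⊗ q) ≡ mapExp φ p ⊗ mapExp φ q
      mapExp-⊗ []            q = ≡.refl
      mapExp-⊗ ((a , m) ∷ p) q = ≡.trans (mapExp-++ ((a , m) *ₜ q) (p ⊗ q))
                                         (≡.cong₂ _++_ (mapExp-*ₜ a m q) (mapExp-⊗ p q))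

  sw-⊗ : ∀ k p q → sw k (p ⊗ q) ≡ sw k p ⊗ sw k q
  sw-⊗ k = mapExp-⊗ (swapExp-zipWith ℤ._+_ k)

  sw-⊖ : ∀ k p q → sw k (p ⊖ q) ≡ sw k p ⊖ sw k q
  sw-⊖ k p q = ≡.trans (mapExp-++ p (negP q)) (≡.cong (sw k p ++_) (mapExp-negP q))

  sw-cong : ∀ k {p q} → p ≃ q → sw k p ≃ sw k q
  sw-cong k = mapExp-cong (swapExp-involutive k)

  sw-involutive : ∀ k p → sw k (sw k p) ≡ p
  sw-involutive k []            = ≡.refl
  sw-involutive k ((a , m) ∷ p) = ≡.cong₂ (λ v q → (a , v) ∷ q) (swapExp-involutive k m) (sw-involutive k p)

  sw-oneP : ∀ k → sw k oneP ≡ oneP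
  sw-oneP k = ≡.cong monomial (swapExp-0ᵉ k)

  revInv-⊗ : ∀ p q → revInv (p ⊗ q) ≡ revInv p ⊗ revInv q
  revInv-⊗ = mapExp-⊗ revInvᵉ-+ᵉ

  revInv-⊖ : ∀ p q → revInv (p ⊖ q) ≡ revInv p ⊖ revInv q
  revInv-⊖ p q = ≡.trans (mapExp-++ p (negP q)) (≡.cong (revInv p ++_) (mapExp-negP q))

  revInv-cong : ∀ {p q} → p ≃ q → revInv p ≃ revInv q
  revInv-cong = mapExp-cong revInvᵉ-involutive

  CT-cong : ∀ {p q} → p ≃ q → CT p ≈ CT q
  CT-cong (≋⇒≃ p≋q) = p≋q 0ᵉ

  CT-⊖ : ∀ p q → CT (p ⊖ q) ≈ CT p - CT q
  CT-⊖ p q = trans (coeff-++ p (negP q) 0ᵉ) (+-congˡ (coeff-negP q 0ᵉ))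

  CT-sw : ∀ k p → CT (sw k p) ≈ CT p
  CT-sw k p = trans (coeff-mapExp (swapExp-involutive k) p 0ᵉ) (reflexive (≡.cong (coeff p) (swapExp-0ᵉ k)))

module PairingLinearity {c ℓ} (R : CommutativeRing c ℓ) (n : ℕ) where

  open CommutativeRing R
  open Laurent R n
  open LaurentRing R n
  module L = CommutativeRing ⊕-⊗-commutativeRing
  open Algebra.Properties.Ring L.ring using ([y-z]x≈yx-zx; x[y-z]≈xy-xz)

  pairA-congʳ : ∀ f {g g′} → g ≃ g′ → pairA f g ≈ pairA f g′
  pairA-congʳ f g≃g′ = CT-cong (L.*-congʳ (L.*-congˡ {x = f} (revInv-cong g≃g′)))

  pairA-⊖ʳ : ∀ f p g → pairA f (p ⊖ g) ≈ pairA f p - pairA f g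
  pairA-⊖ʳ f p g = trans (CT-cong (L.*-congʳ (≃-trans (≡⇒≃ (≡.cong (f ⊗_) (revInv-⊖ p g)))
                                                      (x[y-z]≈xy-xz f (revInv p) (revInv g)))))
                         (trans (CT-cong ([y-z]x≈yx-zx Δ (f ⊗ revInv p) (f ⊗ revInv g)))
                                (CT-⊖ (f ⊗ revInv p ⊗ Δ) (f ⊗ revInv g ⊗ Δ)))

module AdjacentVariables {c ℓ} (R : CommutativeRing c ℓ) {m : ℕ} (j : Fin m) where

  open Laurent R (suc m)

  k : ℕ
  k = suc (toℕ j)

  -- the (0-based) positions of x_k and x_{k+1}
  a b : Fin (suc m)
  a = inject₁ j
  b = Fin.suc j

  a≢b : a ≢ b
  a≢b a≡b = ℕₚ.<-irrefl (≡.trans (≡.sym (Finₚ.toℕ-inject₁ j)) (≡.cong toℕ a≡b)) (ℕₚ.n<1+n (toℕ j))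

  -- ua is unit a only up to toℕ-inject₁; stated through k it makes Xa definitionally xv k.
  ua ub : Exp (suc m)
  ua = unitExp (suc m) k
  ub = unit b

  Xa Xb D : LPoly
  Xa = xv k
  Xb = xv (suc k)
  D  = Xa ⊖ Xb

  swapExp-ua : swapExp k ua ≡ ub
  swapExp-ua = ≡.trans (≡.cong (swapExp k) (unit-inject₁ j))
                       (≡.trans (swapExp-unit j a) (≡.cong unit (transpose-matchˡ a b)))

  swapExp-ub : swapExp k ub ≡ ua
  swapExp-ub = ≡.trans (swapExp-unit j b) (≡.trans (≡.cong unit (transpose-matchʳ a b)) (≡.sym (unit-inject₁ j)))

  sw-Xa : sw k Xa ≡ Xb
  sw-Xa = ≡.cong monomial swapExp-ua

  sw-Xb : sw k Xb ≡ Xa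
  sw-Xb = ≡.cong monomial swapExp-ub

module Regularity {c ℓ} (R : CommutativeRing c ℓ) {m : ℕ} (j : Fin m) where

  open CommutativeRing R
  open Laurent R (suc m)
  open LaurentRing R (suc m)
  open AdjacentVariables R j
  open import Algebra.Properties.Ring ring using (-1*x≈-x)
  open import Algebra.Properties.Group +-group using (x∙y⁻¹≈ε⇒x≈y)
  open ≈-Reasoning

  private
    x≡y+n[1-0]⇒∣x-y∣≡n : ∀ x y n → x ≡ y ℤ.+ + n ℤ.* (+ 1 ℤ.- + 0) → ℤ.∣ x ℤ.- y ∣ ≡ n
    x≡y+n[1-0]⇒∣x-y∣≡n x y n ≡.refl = ≡.cong ℤ.∣_∣ (lemma y (+ n))
      where
      lemma : ∀ y n → y ℤ.+ n ℤ.* (+ 1 ℤ.- + 0) ℤ.- y ≡ n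
      lemma = solve-∀

  δ : Exp (suc m)
  δ = ua -ᵉ ub

  lookup-+ᵉ⋆ᵉδ : ∀ v t → lookup (v +ᵉ t ⋆ᵉ δ) a ≡ lookup v a ℤ.+ + t ℤ.* (+ 1 ℤ.- + 0)
  lookup-+ᵉ⋆ᵉδ v t = ≡.trans (lookup-+ᵉ⋆ᵉ v t ua ub a)
    (≡.cong₂ (λ x y → lookup v a ℤ.+ + t ℤ.* (x ℤ.- y))
             (≡.trans (≡.cong (λ u → lookup u a) (unit-inject₁ j)) (lookup-unit-self a))
             (lookup-unit-other a≢b))

  coeff-D⊗ : ∀ X e → coeff (D ⊗ X) e ≈ coeff X (e -ᵉ ua) - coeff X (e -ᵉ ub)
  coeff-D⊗ X e = begin
    coeff ((1# , ua) *ₜ X ++ ((- 1# , ub) *ₜ X ++ [])) e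
      ≈⟨ coeff-++ ((1# , ua) *ₜ X) _ e ⟩
    coeff ((1# , ua) *ₜ X) e + coeff ((- 1# , ub) *ₜ X ++ []) e
      ≈⟨ +-cong (coeff-*ₜ 1# ua X e)
                (trans (coeff-++ ((- 1# , ub) *ₜ X) [] e) (trans (+-identityʳ _) (coeff-*ₜ (- 1#) ub X e))) ⟩
    1# * coeff X (e -ᵉ ua) + - 1# * coeff X (e -ᵉ ub)
      ≈⟨ +-cong (*-identityˡ _) (-1*x≈-x _) ⟩
    coeff X (e -ᵉ ua) - coeff X (e -ᵉ ub) ∎

  -- If X (x_k - x_{k+1}) = 0, the coefficients of X are constant along the direction
  -- δ = e_k - e_{k+1}, while those of the finite list X vanish far out along it.
  module _ {X : LPoly} (X⊗D≃0 : X ⊗ D ≃ zeroP) where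

    coeff-+ᵉδ : ∀ v → coeff X v ≈ coeff X (v +ᵉ δ)
    coeff-+ᵉδ v = x∙y⁻¹≈ε⇒x≈y _ _ (begin
      coeff X v - coeff X (v +ᵉ δ)
        ≡⟨ ≡.cong₂ (λ u w → coeff X u - coeff X w) ([u+v]-v≡u v ua) ([u+v]-w≡u+[v-w] v ua ub) ⟨
      coeff X ((v +ᵉ ua) -ᵉ ua) - coeff X ((v +ᵉ ua) -ᵉ ub)  ≈⟨ coeff-D⊗ X (v +ᵉ ua) ⟨
      coeff (D ⊗ X) (v +ᵉ ua)                               ≈⟨ ≃⇒≋ (≃-trans (⊗-comm D X) X⊗D≃0) (v +ᵉ ua) ⟩
      0#                                                     ∎)

    coeff-+ᵉ⋆ᵉδ : ∀ v t → coeff X v ≈ coeff X (v +ᵉ t ⋆ᵉ δ)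
    coeff-+ᵉ⋆ᵉδ v zero    = reflexive (≡.cong (coeff X) (≡.sym (+ᵉ-identityʳ v)))
    coeff-+ᵉ⋆ᵉδ v (suc t) = trans (coeff-+ᵉ⋆ᵉδ v t) (trans (coeff-+ᵉδ (v +ᵉ t ⋆ᵉ δ))
      (reflexive (≡.cong (coeff X) (≡.trans (+ᵉ-assoc v (t ⋆ᵉ δ) δ) (≡.cong (v +ᵉ_) (+ᵉ-comm (t ⋆ᵉ δ) δ))))))

  coeff-+ᵉ⋆ᵉδ-eventually-0 : ∀ Y v → Σ ℕ λ T → ∀ t → T ℕ.≤ t → coeff Y (v +ᵉ t ⋆ᵉ δ) ≈ 0#
  coeff-+ᵉ⋆ᵉδ-eventually-0 []            v = 0 , λ _ _ → refl
  coeff-+ᵉ⋆ᵉδ-eventually-0 ((c , e) ∷ Y) v = suc d ℕ.⊔ T , beyond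
    where
    d = ℤ.∣ lookup e a ℤ.- lookup v a ∣
    T = proj₁ (coeff-+ᵉ⋆ᵉδ-eventually-0 Y v)
    beyond : ∀ t → suc d ℕ.⊔ T ℕ.≤ t → coeff ((c , e) ∷ Y) (v +ᵉ t ⋆ᵉ δ) ≈ 0#
    beyond t T′≤t = trans (coeff-∷-≢ e≢) (proj₂ (coeff-+ᵉ⋆ᵉδ-eventually-0 Y v) t (ℕₚ.m⊔n≤o⇒n≤o (suc d) T T′≤t))
      where
      e≢ : e ≢ v +ᵉ t ⋆ᵉ δ
      e≢ e≡ = ℕₚ.<⇒≢ (ℕₚ.m⊔n≤o⇒m≤o (suc d) T T′≤t)
                (x≡y+n[1-0]⇒∣x-y∣≡n _ _ t (≡.trans (≡.cong (λ u → lookup u a) e≡) (lookup-+ᵉ⋆ᵉδ v t)))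

  D-regular : ∀ {X} → X ⊗ D ≃ zeroP → X ≃ zeroP
  D-regular {X} X⊗D≃0 = ≋⇒≃ λ v →
    let (T , beyond) = coeff-+ᵉ⋆ᵉδ-eventually-0 X v in
    trans (coeff-+ᵉ⋆ᵉδ {X} X⊗D≃0 v T) (beyond T ℕₚ.≤-refl)

module DividedDifference {c ℓ} (R : CommutativeRing c ℓ) {m : ℕ} (j : Fin m) where

  open Laurent R (suc m)
  open LaurentRing R (suc m)
  open AdjacentVariables R j
  open Regularity R j using (D-regular)
  open CommutativeRing ⊕-⊗-commutativeRing
  open CommutativeRingIdentities ⊕-⊗-commutativeRing
  open import Algebra.Properties.Ring ring using ([y-z]x≈yx-zx; x[y-z]≈xy-xz; -‿distribʳ-*)
  open import Algebra.Properties.AbelianGroup +-abelianGroup using (⁻¹-anti-homo‿-)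
  open import Algebra.Properties.Group +-group using (x∙y⁻¹≈ε⇒x≈y; x≈y⇒x∙y⁻¹≈ε)
  open ≃-Reasoning

  sw-D : sw k D ≡ Xb - Xa
  sw-D = ≡.trans (sw-⊖ k Xa Xb) (≡.cong₂ _-_ sw-Xa sw-Xb)

  IsPi⇒sw-invariant : ∀ f h → IsPi k f h → sw k h ≈ h
  IsPi⇒sw-invariant f h isPi = x∙y⁻¹≈ε⇒x≈y (sw k h) h (D-regular (begin
    (sw k h - h) * D        ≈⟨ [y-z]x≈yx-zx D (sw k h) h ⟩
    sw k h * D - h * D      ≈⟨ x≈y⇒x∙y⁻¹≈ε swh*D≈h*D ⟩
    0#                      ∎))
    where
    swh*D≈h*D : sw k h * D ≈ h * D
    swh*D≈h*D = begin
      sw k h * D                          ≈⟨ *-congˡ {x = sw k h} (⁻¹-anti-homo‿- Xb Xa) ⟨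
      sw k h * - (Xb - Xa)                ≈⟨ -‿distribʳ-* (sw k h) (Xb - Xa) ⟨
      - (sw k h * (Xb - Xa))              ≡⟨ ≡.cong (λ p → - (sw k h * p)) sw-D ⟨
      - (sw k h * sw k D)                 ≡⟨ ≡.cong -_ (sw-⊗ k h D) ⟨
      - sw k (h * D)                      ≈⟨ -‿cong (sw-cong k (≋⇒≃ isPi)) ⟩
      - sw k (Xa * f - Xb * sw k f)       ≡⟨ ≡.cong -_ sw-rhs ⟩
      - (Xb * sw k f - Xa * f)            ≈⟨ ⁻¹-anti-homo‿- (Xb * sw k f) (Xa * f) ⟩
      Xa * f - Xb * sw k f                ≈⟨ ≋⇒≃ isPi ⟨
      h * D                               ∎
      where
      sw-rhs : sw k (Xa * f - Xb * sw k f) ≡ Xb * sw k f - Xa * f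
      sw-rhs = ≡.trans (sw-⊖ k (Xa * f) (Xb * sw k f))
               (≡.cong₂ _-_ (≡.trans (sw-⊗ k Xa f) (≡.cong (_* sw k f) sw-Xa))
                            (≡.trans (sw-⊗ k Xb (sw k f)) (≡.cong₂ _*_ sw-Xb (sw-involutive k f))))

  IsPi-idempotent : ∀ f h → IsPi k f h → IsPi k h h
  IsPi-idempotent f h isPi = ≃⇒≋ (begin
    h * (Xa - Xb)             ≈⟨ x[y-z]≈xy-xz h Xa Xb ⟩
    h * Xa - h * Xb           ≈⟨ +-cong (*-comm h Xa) (-‿cong (*-comm h Xb)) ⟩
    Xa * h - Xb * h           ≈⟨ +-congˡ {x = Xa * h} (-‿cong (*-congˡ {x = Xb} (IsPi⇒sw-invariant f h isPi))) ⟨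
    Xa * h - Xb * sw k h      ∎)

  private
    x-y≡n⇒x≡y+n : ∀ x y n → x ℤ.- y ≡ n → x ≡ y ℤ.+ n
    x-y≡n⇒x≡y+n x y n ≡.refl = lemma x y
      where
      lemma : ∀ x y → x ≡ y ℤ.+ (x ℤ.- y)
      lemma = solve-∀

    x-y≡n⇒y≡x-n : ∀ x y n → x ℤ.- y ≡ n → y ≡ x ℤ.+ ℤ.- n
    x-y≡n⇒y≡x-n x y n ≡.refl = lemma x y
      where
      lemma : ∀ x y → y ≡ x ℤ.+ ℤ.- (x ℤ.- y)
      lemma = solve-∀

  t s : LPoly
  t = monomial (ub -ᵉ ua)
  s = monomial (ua -ᵉ ub)

  Xb≈Xa*t : Xb ≈ Xa * t
  Xb≈Xa*t = sym (≃-trans (monomial-⊗ ua (ub -ᵉ ua)) (≡⇒≃ (≡.cong monomial (u+[v-u]≡v ua ub))))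

  s*t≈1 : s * t ≈ 1#
  s*t≈1 = ≃-trans (monomial-⊗ (ua -ᵉ ub) (ub -ᵉ ua)) (≡⇒≃ (≡.cong monomial ([u-v]+[v-u]≡0ᵉ ua ub)))

  monomial-^ : ∀ v N → monomial v ^ N ≈ monomial (N ⋆ᵉ v)
  monomial-^ v zero    = refl
  monomial-^ v (suc N) = ≃-trans (*-congˡ {x = monomial v} (monomial-^ v N)) (monomial-⊗ v (N ⋆ᵉ v))

  swapExp-shift : ∀ e N → lookup e a ≡ lookup e b ℤ.+ + N → swapExp k e ≡ e +ᵉ N ⋆ᵉ (ub -ᵉ ua)
  swapExp-shift e N eₐ≡e_b+N = ≡-by-lookup λ x →
    ≡.trans (lookup-swapExp j e x)
            (≡.trans (transpose-shift e N a≢b eₐ≡e_b+N x)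
                     (≡.cong (λ u → lookup (e +ᵉ N ⋆ᵉ (ub -ᵉ u)) x) (≡.sym (unit-inject₁ j))))

  swapExp-shift′ : ∀ e N → lookup e b ≡ lookup e a ℤ.+ + N → swapExp k e ≡ e +ᵉ N ⋆ᵉ (ua -ᵉ ub)
  swapExp-shift′ e N e_b≡eₐ+N = ≡-by-lookup λ x →
    ≡.trans (lookup-swapExp j e x)
            (≡.trans (≡.cong (lookup e) (transpose-comm a b x))
                     (≡.trans (transpose-shift e N (a≢b ∘ ≡.sym) e_b≡eₐ+N x)
                              (≡.cong (λ u → lookup (e +ᵉ N ⋆ᵉ (u -ᵉ ub)) x) (≡.sym (unit-inject₁ j)))))

  sw-term : ∀ c e v N → swapExp k e ≡ e +ᵉ N ⋆ᵉ v → sw k ((c , e) ∷ []) ≈ ((c , e) ∷ []) * monomial v ^ N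
  sw-term c e v N swapExp-e≡ = begin
    (c , swapExp k e) ∷ []              ≡⟨ ≡.cong (λ u → (c , u) ∷ []) swapExp-e≡ ⟩
    (c , e +ᵉ N ⋆ᵉ v) ∷ []              ≈⟨ term-⊗-monomial c e (N ⋆ᵉ v) ⟨
    ((c , e) ∷ []) * monomial (N ⋆ᵉ v)  ≈⟨ *-congˡ {x = (c , e) ∷ []} (monomial-^ v N) ⟨
    ((c , e) ∷ []) * monomial v ^ N     ∎

  -- For a term q with e_k - e_{k+1} = N ≥ 0 one has q^{s_k} = q t^N, so q π_k = q (1 + t + ⋯ + t^N);
  -- if e_k - e_{k+1} = -(M + 1) then q^{s_k} = q s^{M+1} and q π_k = - q s (1 + s + ⋯ + s^{M-1}).
  demazureFactor : ℤ → LPoly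
  demazureFactor (+ N)    = geometric (suc N) t
  demazureFactor -[1+ M ] = - (s * geometric M s)

  demazure : LPoly → LPoly
  demazure []            = []
  demazure ((c , e) ∷ f) = ((c , e) ∷ []) * demazureFactor (lookup e a ℤ.- lookup e b) + demazure f

  demazure-term : ∀ c e → let q = (c , e) ∷ [] in
                  (q * demazureFactor (lookup e a ℤ.- lookup e b)) * D ≈ Xa * q - Xb * sw k q
  demazure-term c e with lookup e a ℤ.- lookup e b in eq
  ... | + N =
    divided-difference-of-multiple {q} {sw k q} {Xa} {Xb} {t} {t ^ N} {geometric (suc N) t}
      (geometric-telescope (suc N) t) (sw-term c e (ub -ᵉ ua) N (swapExp-shift e N eₐ≡e_b+N)) Xb≈Xa*t
    where
    q = (c , e) ∷ []
    eₐ≡e_b+N = x-y≡n⇒x≡y+n (lookup e a) (lookup e b) (+ N) eq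
  ... | -[1+ M ] =
    divided-difference-of-multiple {q} {sw k q} {Xa} {Xb} {t} {s ^ suc M} { - (s * geometric M s)}
      (geometric-telescope⁻ M s*t≈1) (sw-term c e (ua -ᵉ ub) (suc M) (swapExp-shift′ e (suc M) e_b≡eₐ+1+M)) Xb≈Xa*t
    where
    q = (c , e) ∷ []
    e_b≡eₐ+1+M = x-y≡n⇒y≡x-n (lookup e a) (lookup e b) -[1+ M ] eq

  demazure-isPi : ∀ f → IsPi k f (demazure f)
  demazure-isPi f = ≃⇒≋ (demazure*D f)
    where
    demazure*D : ∀ f → demazure f * D ≈ Xa * f - Xb * sw k f
    demazure*D []            = refl
    demazure*D ((c , e) ∷ f) = begin
      (T + demazure f) * D                      ≈⟨ distribʳ D T (demazure f) ⟩
      T * D + demazure f * D                    ≈⟨ +-cong (demazure-term c e) (demazure*D f) ⟩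
      (Xa * q - Xb * sw k q) + (Xa * f - Xb * sw k f)
        ≈⟨ [x-y]+[z-w]≈[x+z]-[y+w] (Xa * q) (Xb * sw k q) (Xa * f) (Xb * sw k f) ⟩
      (Xa * q + Xa * f) - (Xb * sw k q + Xb * sw k f)
        ≈⟨ +-cong (distribˡ Xa q f) (-‿cong (distribˡ Xb (sw k q) (sw k f))) ⟨
      Xa * (q + f) - Xb * (sw k q + sw k f)     ∎
      where
      q = (c , e) ∷ []
      T = q * demazureFactor (lookup e a ℤ.- lookup e b)

module KernelProduct {c ℓ} (R : CommutativeRing c ℓ) (n : ℕ) where

  open Laurent R n
  open LaurentRing R n
  open CommutativeRing ⊕-⊗-commutativeRing
  open ListSums *-monoid using () renaming (sumˡ to ∏ˡ; sumˡ-cong to ∏ˡ-cong; sumˡ-concatMap to ∏ˡ-concatMap;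
    sumˡ-map to ∏ˡ-map; sumˡ-filterᵇ to ∏ˡ-filterᵇ; sumˡ-tabulate to ∏ˡ-tabulate)
  open import Algebra.Properties.CommutativeMonoid.Sum *-commutativeMonoid using () renaming (sum to ∏)
  open ≃-Reasoning

  lt : Fin n → Fin n → Bool
  lt x y = toℕ x ℕ.<ᵇ toℕ y

  ψ : Fin n → Fin n → LPoly
  ψ x y = if lt x y then factor (x , y) else 1#

  Δ≈∏∏ψ : Δ ≈ ∏ λ x → ∏ (ψ x)
  Δ≈∏∏ψ = begin
    ∏ˡ factor pairs
      ≈⟨ ∏ˡ-concatMap factor row (List.allFin n) ⟩
    ∏ˡ (∏ˡ factor ∘ row) (List.allFin n)
      ≈⟨ ∏ˡ-cong (∏ˡ factor ∘ row) ∏row≈∏ψ (List.allFin n) ⟩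
    ∏ˡ (λ x → ∏ (ψ x)) (List.allFin n)
      ≡⟨ ∏ˡ-tabulate (λ x → ∏ (ψ x)) id ⟩
    ∏ (λ x → ∏ (ψ x)) ∎
    where
    row : Fin n → List (Fin n × Fin n)
    row x = List.map (x ,_) (List.filterᵇ (lt x) (List.allFin n))
    ∏row≈∏ψ : ∀ x → ∏ˡ factor (row x) ≈ ∏ (ψ x)
    ∏row≈∏ψ x = begin
      ∏ˡ factor (row x)                                           ≡⟨ ∏ˡ-map factor (x ,_) (List.filterᵇ (lt x) (List.allFin n)) ⟩
      ∏ˡ (factor ∘ (x ,_)) (List.filterᵇ (lt x) (List.allFin n))  ≈⟨ ∏ˡ-filterᵇ (factor ∘ (x ,_)) (lt x) (List.allFin n) ⟩
      ∏ˡ (ψ x) (List.allFin n)                                    ≡⟨ ∏ˡ-tabulate (ψ x) id ⟩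
      ∏ (ψ x)                                                     ∎

module DeltaFactorisation {c ℓ} (R : CommutativeRing c ℓ) {m : ℕ} (j : Fin m) where

  private
    <⇒<ᵇ≡true : ∀ {x y} → x < y → (x ℕ.<ᵇ y) ≡ true
    <⇒<ᵇ≡true x<y = Equivalence.to T-≡ (ℕₚ.<⇒<ᵇ x<y)

    <ᵇ≡true⇒< : ∀ {x y} → (x ℕ.<ᵇ y) ≡ true → x < y
    <ᵇ≡true⇒< {x} {y} eq = ℕₚ.<ᵇ⇒< x y (Equivalence.from T-≡ eq)

  open Laurent R (suc m)
  open LaurentRing R (suc m)
  open AdjacentVariables R j
  open KernelProduct R (suc m)
  open CommutativeRing ⊕-⊗-commutativeRing
  open FinSums *-commutativeMonoid using () renaming (sum-pull to ∏-pull)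
  open import Algebra.Properties.CommutativeMonoid.Sum *-commutativeMonoid using ()
    renaming (sum to ∏; sum-cong-≋ to ∏-cong; sum-cong-≗ to ∏-cong-≗; sum-permute to ∏-permute)
  open ≃-Reasoning

  τ : Fin (suc m) → Fin (suc m)
  τ = adjacentSwap j ⟨$⟩ʳ_

  toℕ-a : toℕ a ≡ toℕ j
  toℕ-a = Finₚ.toℕ-inject₁ j

  ordered-after-swap : ∀ x y → toℕ x < toℕ y → ¬ (x ≡ a × y ≡ b) → toℕ (τ x) < toℕ (τ y)
  ordered-after-swap x y x<y ¬ab with transpositionView a b x | transpositionView a b y
  ... | at-i ≡.refl | at-i ≡.refl = contradiction x<y (ℕₚ.<-irrefl ≡.refl)
  ... | at-i ≡.refl | at-j ≡.refl = contradiction (≡.refl , ≡.refl) ¬ab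
  ... | at-i ≡.refl | elsewhere y≢a y≢b
    rewrite transpose-matchˡ a b | transpose-other y≢a y≢b =
    ℕₚ.≤∧≢⇒< (≡.subst (_< toℕ y) toℕ-a x<y) (y≢b ∘ Finₚ.toℕ-injective ∘ ≡.sym)
  ... | at-j ≡.refl | at-i ≡.refl = contradiction (≡.subst (toℕ b <_) toℕ-a x<y) (ℕₚ.<-asym (ℕₚ.n<1+n (toℕ j)))
  ... | at-j ≡.refl | at-j ≡.refl = contradiction x<y (ℕₚ.<-irrefl ≡.refl)
  ... | at-j ≡.refl | elsewhere y≢a y≢b
    rewrite transpose-matchʳ a b | transpose-other y≢a y≢b | toℕ-a = ℕₚ.<-trans (ℕₚ.n<1+n (toℕ j)) x<y
  ... | elsewhere x≢a x≢b | at-i ≡.refl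
    rewrite transpose-matchˡ a b | transpose-other x≢a x≢b | toℕ-a = ℕₚ.m<n⇒m<1+n x<y
  ... | elsewhere x≢a x≢b | at-j ≡.refl
    rewrite transpose-matchʳ a b | transpose-other x≢a x≢b | toℕ-a =
    ℕₚ.≤∧≢⇒< (ℕₚ.≤-pred x<y) (x≢a ∘ Finₚ.toℕ-injective ∘ (λ e → ≡.trans e (≡.sym toℕ-a)))
  ... | elsewhere x≢a x≢b | elsewhere y≢a y≢b
    rewrite transpose-other x≢a x≢b | transpose-other y≢a y≢b = x<y

  -- The pairs x < y that stay ordered after swapping a and b: all but (a , b). Being τ-stable
  -- by construction, they make Δ′ symmetric in x_k and x_{k+1}.
  mask : Fin (suc m) → Fin (suc m) → Bool
  mask x y = lt x y ∧ lt (τ x) (τ y)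

  ψ′ : Fin (suc m) → Fin (suc m) → LPoly
  ψ′ x y = if mask x y then factor (x , y) else 1#

  Δ′ : LPoly
  Δ′ = ∏ λ x → ∏ (ψ′ x)

  mask≡lt : ∀ x y → ¬ (x ≡ a × y ≡ b) → mask x y ≡ lt x y
  mask≡lt x y ¬ab with lt x y in eq
  ... | false = ≡.refl
  ... | true  = <⇒<ᵇ≡true (ordered-after-swap x y (<ᵇ≡true⇒< eq) ¬ab)

  lt-a-b : lt a b ≡ true
  lt-a-b = <⇒<ᵇ≡true (≡.subst (_< toℕ b) (≡.sym toℕ-a) (ℕₚ.n<1+n (toℕ j)))

  mask-a-b : mask a b ≡ false
  mask-a-b rewrite transpose-matchˡ a b | transpose-matchʳ a b | lt-a-b with lt b a in eq
  ... | false = ≡.refl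
  ... | true  = contradiction (≡.subst (toℕ b <_) toℕ-a (<ᵇ≡true⇒< eq)) (ℕₚ.<-asym (ℕₚ.n<1+n (toℕ j)))

  mask-τ : ∀ x y → mask (τ x) (τ y) ≡ mask x y
  mask-τ x y rewrite transpose-involutive a b x | transpose-involutive a b y = ∧-comm (lt (τ x) (τ y)) (lt x y)

  Δ≈factor*Δ′ : Δ ≈ factor (a , b) * Δ′
  Δ≈factor*Δ′ = trans Δ≈∏∏ψ (∏-pull a (factor (a , b)) row-agrees row-a)
    where
    entry-agrees : ∀ x y → ¬ (x ≡ a × y ≡ b) → ψ x y ≈ ψ′ x y
    entry-agrees x y ¬ab = reflexive (≡.cong (if_then factor (x , y) else 1#) (≡.sym (mask≡lt x y ¬ab)))
    row-agrees : ∀ x → x ≢ a → ∏ (ψ x) ≈ ∏ (ψ′ x)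
    row-agrees x x≢a = ∏-cong λ y → entry-agrees x y (x≢a ∘ proj₁)
    row-a : ∏ (ψ a) ≈ factor (a , b) * ∏ (ψ′ a)
    row-a = ∏-pull b (factor (a , b)) (λ y y≢b → entry-agrees a y (y≢b ∘ proj₂)) (begin
      ψ a b               ≡⟨ ≡.cong (if_then factor (a , b) else 1#) lt-a-b ⟩
      factor (a , b)      ≈⟨ *-identityʳ (factor (a , b)) ⟨
      factor (a , b) * 1# ≡⟨ ≡.cong (λ c → factor (a , b) * (if c then factor (a , b) else 1#)) mask-a-b ⟨
      factor (a , b) * ψ′ a b ∎)

  sw-factor : ∀ x y → sw k (factor (x , y)) ≡ factor (τ x , τ y)
  sw-factor x y = ≡.trans (sw-⊖ k oneP (monomial (unit x -ᵉ unit y)))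
    (≡.cong₂ (λ p e → p ⊖ monomial e) (sw-oneP k)
      (≡.trans (swapExp-zipWith ℤ._-_ k (unit x) (unit y)) (≡.cong₂ _-ᵉ_ (swapExp-unit j x) (swapExp-unit j y))))

  sw-ψ′ : ∀ x y → sw k (ψ′ x y) ≡ ψ′ (τ x) (τ y)
  sw-ψ′ x y = ≡.trans (sw-if (mask x y)) (≡.cong (if_then factor (τ x , τ y) else 1#) (≡.sym (mask-τ x y)))
    where
    sw-if : ∀ c → sw k (if c then factor (x , y) else 1#) ≡ (if c then factor (τ x , τ y) else 1#)
    sw-if true  = sw-factor x y
    sw-if false = sw-oneP k

  sw-∏ : ∀ {n′} (f : Fin n′ → LPoly) → sw k (∏ f) ≡ ∏ (sw k ∘ f)
  sw-∏ {zero}   f = sw-oneP k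
  sw-∏ {suc n′} f = ≡.trans (sw-⊗ k (f Fin.zero) (∏ (f ∘ Fin.suc))) (≡.cong (sw k (f Fin.zero) *_) (sw-∏ (f ∘ Fin.suc)))

  sw-Δ′ : sw k Δ′ ≈ Δ′
  sw-Δ′ = begin
    sw k Δ′                                  ≡⟨ sw-∏ (λ x → ∏ (ψ′ x)) ⟩
    ∏ (λ x → sw k (∏ (ψ′ x)))                ≈⟨ ∏-cong (λ x → ≡⇒≃ (≡.trans (sw-∏ (ψ′ x)) (∏-cong-≗ (sw-ψ′ x)))) ⟩
    ∏ (λ x → ∏ (λ y → ψ′ (τ x) (τ y)))       ≈⟨ ∏-cong (λ x → ∏-permute (ψ′ (τ x)) (adjacentSwap j)) ⟨
    ∏ (λ x → ∏ (ψ′ (τ x)))                   ≈⟨ ∏-permute (λ x → ∏ (ψ′ x)) (adjacentSwap j) ⟨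
    Δ′                                       ∎

module Adjointness {c ℓ} (R : CommutativeRing c ℓ) {m : ℕ} (j : Fin m) where

  open CommutativeRing R renaming (Carrier to K)
  open Laurent R (suc m)
  open LaurentRing R (suc m)
  open AdjacentVariables R (opposite j)
  open DeltaFactorisation R (opposite j) using (Δ′; Δ≈factor*Δ′; sw-Δ′)
  module L = CommutativeRing ⊕-⊗-commutativeRing
  open Algebra.Properties.Ring L.ring using ([y-z]x≈yx-zx; x[y-z]≈xy-xz)
  open Algebra.Properties.CommutativeSemigroup L.*-commutativeSemigroup using (xy∙z≈xz∙y; x∙yz≈y∙xz)
  open CommutativeRingIdentities ⊕-⊗-commutativeRing using (divided-difference-rescale)
  open ≈-Reasoning

  i : ℕ
  i = suc (toℕ j)

  Ya Yb : LPoly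
  Ya = monomial (-ᵉ ua)
  Yb = monomial (-ᵉ ub)

  Xa⊗Ya≃1 : Xa ⊗ Ya ≃ oneP
  Xa⊗Ya≃1 = ≃-trans (monomial-⊗ ua (-ᵉ ua)) (≡⇒≃ (≡.cong monomial (+ᵉ-inverseʳ ua)))

  Xb⊗Yb≃1 : Xb ⊗ Yb ≃ oneP
  Xb⊗Yb≃1 = ≃-trans (monomial-⊗ ub (-ᵉ ub)) (≡⇒≃ (≡.cong monomial (+ᵉ-inverseʳ ub)))

  μ F : LPoly
  μ = Xa ⊗ Yb
  F = factor (a , b)

  F≃1-μ : F ≃ oneP ⊖ μ
  F≃1-μ = L.+-congˡ {x = oneP} (L.-‿cong (≃-sym (≃-trans (monomial-⊗ ua (-ᵉ ub))
    (≡⇒≃ (≡.cong monomial (≡.trans (u+[-v]≡u-v ua ub) (≡.cong (_-ᵉ ub) (unit-inject₁ (opposite j)))))))))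

  revInv-xᵢ : revInv (xv i) ≡ Yb
  revInv-xᵢ = ≡.cong monomial (≡.trans (≡.cong revInvᵉ (unit-inject₁ j))
    (≡.trans (revInvᵉ-unit (inject₁ j)) (≡.cong (-ᵉ_ ∘ unit) (opposite-inject₁ j))))

  revInv-xᵢ₊₁ : revInv (xv (suc i)) ≡ Ya
  revInv-xᵢ₊₁ = ≡.cong monomial (≡.trans (revInvᵉ-unit (Fin.suc j))
    (≡.cong -ᵉ_ (≡.trans (≡.cong unit (opposite-suc≡inject₁ j)) (≡.sym (unit-inject₁ (opposite j))))))

  revInv-isPi : ∀ g p → IsPi i g p → revInv p ⊗ (Yb ⊖ Ya) ≃ Yb ⊗ revInv g ⊖ Ya ⊗ sw k (revInv g)
  revInv-isPi g p isPi = ≃-trans (≡⇒≃ (≡.sym revInv-lhs)) (≃-trans (revInv-cong (≋⇒≃ isPi)) (≡⇒≃ revInv-rhs))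
    where
    revInv-lhs : revInv (p ⊗ (xv i ⊖ xv (suc i))) ≡ revInv p ⊗ (Yb ⊖ Ya)
    revInv-lhs = ≡.trans (revInv-⊗ p (xv i ⊖ xv (suc i)))
      (≡.cong (revInv p ⊗_) (≡.trans (revInv-⊖ (xv i) (xv (suc i))) (≡.cong₂ _⊖_ revInv-xᵢ revInv-xᵢ₊₁)))
    revInv-rhs : revInv (xv i ⊗ g ⊖ xv (suc i) ⊗ sw i g) ≡ Yb ⊗ revInv g ⊖ Ya ⊗ sw k (revInv g)
    revInv-rhs = ≡.trans (revInv-⊖ (xv i ⊗ g) (xv (suc i) ⊗ sw i g))
      (≡.cong₂ _⊖_ (≡.trans (revInv-⊗ (xv i) g) (≡.cong (_⊗ revInv g) revInv-xᵢ))
                   (≡.trans (revInv-⊗ (xv (suc i)) (sw i g))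
                            (≡.cong₂ _⊗_ revInv-xᵢ₊₁ (mapExp-commute (revInvᵉ-swapExp j) g))))

  isPi⇒⊗F : ∀ f h → IsPi k f h → h ⊗ F ≃ sw k f ⊖ μ ⊗ f
  isPi⇒⊗F f h isPi = ≃-trans (L.*-congˡ {x = h} F≃1-μ)
    (divided-difference-rescale {h} {Xa} {Xb} {f} {sw k f} {Yb} {μ} (≋⇒≃ isPi) Xb⊗Yb≃1 ≃-refl)

  revInv-isPi⇒⊗F : ∀ g p → IsPi i g p → revInv p ⊗ F ≃ sw k (revInv g) ⊖ μ ⊗ revInv g
  revInv-isPi⇒⊗F g p isPi = ≃-trans (L.*-congˡ {x = revInv p} F≃1-μ)
    (divided-difference-rescale {revInv p} {Yb} {Ya} {revInv g} {sw k (revInv g)} {Xa} {μ}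
      (revInv-isPi g p isPi) (≃-trans (⊗-comm Ya Xa) Xa⊗Ya≃1) (⊗-comm Yb Xa))

  ⟪_,_⟫ : LPoly → LPoly → K
  ⟪ u , v ⟫ = CT (u ⊗ v ⊗ Δ′)

  ⟪⟫-congˡ : ∀ {u u′} v → u ≃ u′ → ⟪ u , v ⟫ ≈ ⟪ u′ , v ⟫
  ⟪⟫-congˡ v u≃u′ = CT-cong (L.*-congʳ (L.*-congʳ u≃u′))

  ⟪⟫-congʳ : ∀ u {v v′} → v ≃ v′ → ⟪ u , v ⟫ ≈ ⟪ u , v′ ⟫
  ⟪⟫-congʳ u v≃v′ = CT-cong (L.*-congʳ (L.*-congˡ {x = u} v≃v′))

  ⟪⟫-⊖ˡ : ∀ u u′ v → ⟪ u ⊖ u′ , v ⟫ ≈ ⟪ u , v ⟫ - ⟪ u′ , v ⟫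
  ⟪⟫-⊖ˡ u u′ v = trans (CT-cong (≃-trans (L.*-congʳ ([y-z]x≈yx-zx v u u′)) ([y-z]x≈yx-zx Δ′ (u ⊗ v) (u′ ⊗ v))))
                       (CT-⊖ (u ⊗ v ⊗ Δ′) (u′ ⊗ v ⊗ Δ′))

  ⟪⟫-⊖ʳ : ∀ u v v′ → ⟪ u , v ⊖ v′ ⟫ ≈ ⟪ u , v ⟫ - ⟪ u , v′ ⟫
  ⟪⟫-⊖ʳ u v v′ = trans (CT-cong (≃-trans (L.*-congʳ (x[y-z]≈xy-xz u v v′)) ([y-z]x≈yx-zx Δ′ (u ⊗ v) (u ⊗ v′))))
                       (CT-⊖ (u ⊗ v ⊗ Δ′) (u ⊗ v′ ⊗ Δ′))

  ⟪⟫-⊗ : ∀ w u v → ⟪ w ⊗ u , v ⟫ ≈ ⟪ u , w ⊗ v ⟫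
  ⟪⟫-⊗ w u v = CT-cong (L.*-congʳ (≃-trans (⊗-assoc w u v) (x∙yz≈y∙xz w u v)))

  ⟪⟫-sw : ∀ u v → ⟪ sw k u , v ⟫ ≈ ⟪ u , sw k v ⟫
  ⟪⟫-sw u v = begin
    CT (sw k u ⊗ v ⊗ Δ′)                  ≈⟨ CT-cong (L.*-congˡ {x = sw k u ⊗ v} sw-Δ′) ⟨
    CT (sw k u ⊗ v ⊗ sw k Δ′)             ≡⟨ ≡.cong (λ w → CT (sw k u ⊗ w ⊗ sw k Δ′)) (sw-involutive k v) ⟨
    CT (sw k u ⊗ sw k (sw k v) ⊗ sw k Δ′) ≡⟨ ≡.cong CT (≡.trans (sw-⊗ k (u ⊗ sw k v) Δ′)
                                                          (≡.cong (_⊗ sw k Δ′) (sw-⊗ k u (sw k v)))) ⟨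
    CT (sw k (u ⊗ sw k v ⊗ Δ′))           ≈⟨ CT-sw k (u ⊗ sw k v ⊗ Δ′) ⟩
    CT (u ⊗ sw k v ⊗ Δ′)                  ∎

  pairA≈⟪⟫ˡ : ∀ f g → pairA f g ≈ ⟪ f ⊗ F , revInv g ⟫
  pairA≈⟪⟫ˡ f g = CT-cong (≃-trans (L.*-congˡ {x = f ⊗ revInv g} Δ≈factor*Δ′)
    (≃-trans (≃-sym (⊗-assoc (f ⊗ revInv g) (F) Δ′))
             (L.*-congʳ (xy∙z≈xz∙y f (revInv g) (F)))))

  pairA≈⟪⟫ʳ : ∀ f g → pairA f g ≈ ⟪ f , revInv g ⊗ F ⟫
  pairA≈⟪⟫ʳ f g = CT-cong (≃-trans (L.*-congˡ {x = f ⊗ revInv g} Δ≈factor*Δ′)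
    (≃-trans (≃-sym (⊗-assoc (f ⊗ revInv g) (F) Δ′))
             (L.*-congʳ (⊗-assoc f (revInv g) (F)))))

  pairA-adjoint : ∀ f h g p → IsPi k f h → IsPi i g p → pairA h g ≈ pairA f p
  pairA-adjoint f h g p f-isPi g-isPi = begin
    pairA h g                               ≈⟨ pairA≈⟪⟫ˡ h g ⟩
    ⟪ h ⊗ F , G ⟫              ≈⟨ ⟪⟫-congˡ G (isPi⇒⊗F f h f-isPi) ⟩
    ⟪ sw k f ⊖ μ ⊗ f , G ⟫                  ≈⟨ ⟪⟫-⊖ˡ (sw k f) (μ ⊗ f) G ⟩
    ⟪ sw k f , G ⟫ - ⟪ μ ⊗ f , G ⟫          ≈⟨ +-cong (⟪⟫-sw f G) (-‿cong (⟪⟫-⊗ μ f G)) ⟩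
    ⟪ f , sw k G ⟫ - ⟪ f , μ ⊗ G ⟫          ≈⟨ ⟪⟫-⊖ʳ f (sw k G) (μ ⊗ G) ⟨
    ⟪ f , sw k G ⊖ μ ⊗ G ⟫                  ≈⟨ ⟪⟫-congʳ f (revInv-isPi⇒⊗F g p g-isPi) ⟨
    ⟪ f , revInv p ⊗ F ⟫       ≈⟨ pairA≈⟪⟫ʳ f p ⟨
    pairA f p                               ∎
    where G = revInv g

module HatPairing {c ℓ} (R : CommutativeRing c ℓ) {m : ℕ} (j : Fin m) (g₁ g₂ : Laurent.LPoly R (suc m))
                  (g₂-isπ̂ : Laurent.IsPiHat R (suc m) (suc (toℕ j)) g₁ g₂) where

  open CommutativeRing R
  open import Algebra.Properties.Ring ring using (-0#≈0#)
  open Laurent R (suc m)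
  open LaurentRing R (suc m)
  open PairingLinearity R (suc m)
  open AdjacentVariables R (opposite j) using (k)
  open DividedDifference R (opposite j) using (IsPi-idempotent; demazure; demazure-isPi)
  open Adjointness R j using (pairA-adjoint)
  open ≈-Reasoning

  pairA-π̂ : ∀ f h → IsPi k f h → pairA f g₂ ≈ pairA h g₁ - pairA f g₁
  pairA-π̂ f h f-isPi = begin
    pairA f g₂                   ≈⟨ pairA-congʳ f (≋⇒≃ (proj₂ (proj₂ g₂-isπ̂))) ⟩
    pairA f (p ⊖ g₁)             ≈⟨ pairA-⊖ʳ f p g₁ ⟩
    pairA f p - pairA f g₁       ≈⟨ +-congʳ (pairA-adjoint f h g₁ p f-isPi (proj₁ (proj₂ g₂-isπ̂))) ⟨
    pairA h g₁ - pairA f g₁      ∎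
    where p = proj₁ g₂-isπ̂

  pairA-π̂-dual : ∀ f₁ f₂ → IsPi k f₁ f₂ → pairA f₁ g₁ ≈ 0# → pairA f₂ g₁ ≈ 1# →
                 (pairA f₁ g₂ ≈ 1#) × (pairA f₂ g₂ ≈ 0#)
  pairA-π̂-dual f₁ f₂ f-isPi ⟨f₁,g₁⟩≈0 ⟨f₂,g₁⟩≈1 =
    (begin
      pairA f₁ g₂                  ≈⟨ pairA-π̂ f₁ f₂ f-isPi ⟩
      pairA f₂ g₁ - pairA f₁ g₁    ≈⟨ +-cong ⟨f₂,g₁⟩≈1 (trans (-‿cong ⟨f₁,g₁⟩≈0) -0#≈0#) ⟩
      1# + 0#                      ≈⟨ +-identityʳ 1# ⟩
      1#                           ∎) ,
    (begin
      pairA f₂ g₂                  ≈⟨ pairA-π̂ f₂ f₂ (IsPi-idempotent f₁ f₂ f-isPi) ⟩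
      pairA f₂ g₁ - pairA f₂ g₁    ≈⟨ -‿inverseʳ (pairA f₂ g₁) ⟩
      0#                           ∎)

  pairA-π̂-orthogonal : ∀ {v} (V : LPoly → Set v) → (∀ f h → V f → IsPi k f h → V h) →
                       (∀ f → V f → pairA f g₁ ≈ 0#) → ∀ f → V f → pairA f g₂ ≈ 0#
  pairA-π̂-orthogonal V V-closed V⊥g₁ f f∈V = begin
    pairA f g₂                               ≈⟨ pairA-π̂ f fπ (demazure-isPi f) ⟩
    pairA fπ g₁ - pairA f g₁                 ≈⟨ +-cong (V⊥g₁ fπ fπ∈V) (-‿cong (V⊥g₁ f f∈V)) ⟩
    0# - 0#                                  ≈⟨ -‿inverseʳ 0# ⟩
    0#                                       ∎
    where
    fπ = demazure f
    fπ∈V = V-closed f fπ f∈V (demazure-isPi f)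

suc[m]∸suc[j]≡suc[opposite[j]] : ∀ {m} (j : Fin m) → suc m ∸ suc (toℕ j) ≡ suc (toℕ (opposite j))
suc[m]∸suc[j]≡suc[opposite[j]] j =
  ≡.trans (ℕₚ.+-∸-assoc 1 (Finₚ.toℕ<n j)) (≡.cong suc (≡.sym (Finₚ.opposite-prop j)))

lemma14 : ∀ {c ℓ v} (R : CommutativeRing c ℓ) (n i : ℕ) → 1 ≤ i → i ≤ n ∸ 1 →
    let open CommutativeRing R
        open Laurent R n
    in ∀ (g₁ g₂ : LPoly) → IsPiHat i g₁ g₂ →
       (∀ (f₁ f₂ : LPoly) → IsPi (n ∸ i) f₁ f₂ →
          pairA f₁ g₁ ≈ 0# → pairA f₂ g₁ ≈ 1# →
          (pairA f₁ g₂ ≈ 1#) × (pairA f₂ g₂ ≈ 0#))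
       × (∀ (V : LPoly → Set v) → IsSubspace V →
          (∀ f h → V f → IsPi (n ∸ i) f h → V h) →
          (∀ f → V f → pairA f g₁ ≈ 0#) →
          (∀ f → V f → pairA f g₂ ≈ 0#))
lemma14 R zero    (suc _)  (s≤s z≤n) ()
lemma14 R (suc m) (suc i′) (s≤s z≤n) i′<m with fromℕ< i′<m | Finₚ.toℕ-fromℕ< i′<m
... | j | ≡.refl rewrite suc[m]∸suc[j]≡suc[opposite[j]] j = λ g₁ g₂ g₂-isπ̂ →
  let open HatPairing R j g₁ g₂ g₂-isπ̂ in
  -- the second claim needs only that V is closed under π_{n-i}, not that it is a subspace
  pairA-π̂-dual , λ V _ → pairA-π̂-orthogonal V
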